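{- Let $G_1,G_2$ be two-terminal graphs. As rational functions of $p$, $$y_{G_1\bowtie G_2}=y_{G_1}+y_{G_2}-1,\qquad \hat y_{G_1\parallel G_2}=\hat y_{G_1}\cdot\hat y_{G_2}.$$ Moreover, for any fixed $p_0\in\hat{\mathbb{C}}$: if $y_{G_1}(p_0)$ and $y_{G_2}(p_0)$ are not both $\infty$, then $y_{G_1\bowtie G_2}(p_0)=y_{G_1}(p_0)+y_{G_2}(p_0)-1$; and if $\{\hat y_{G_1}(p_0),\hat y_{G_2}(p_0)\}\neq\{0,\infty\}$, then $\hat y_{G_1\parallel G_2}(p_0)=\hat y_{G_1}(p_0)\hat y_{G_2}(p_0)$.
   Context: Graphs are finite and may have parallel edges. For $G=(V,E)$, $R(G;p)=\sum_{A\subseteq E,\ (V,A)\text{ connected}}(1-p)^{|A|}p^{|E|-|A|}$. A two-terminal graph is $(G,s,t)$ with $s\neq t$. An $s$-$t$ split is a spanning subgraph in which every vertex has a path to exactly one of $s,t$; $S(G;p)=\sum_{A\subseteq E,\ (V,A)\ s\text{ - }t\text{ split}}(1-p)^{|A|}p^{|E|-|A|}$. $y_G(p)=(1-p)S(G;p)/R(G;p)+1$ and $\hat y_G(p)=R(G;p)/S(G;p)+1$, rational functions of $p$ valued in $\hat{\mathbb{C}}$. $G_1\parallel G_2$: disjoint union identifying the two sources (new source) and the two sinks (new sink). $G_1\bowtie G_2$: disjoint union identifying the sink of $G_1$ with the source of $G_2$; source that of $G_1$, sink that of $G_2$. -}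

module Defs where

open import Level using (Level; _⊔_; Lift)
open import Algebra.Bundles using (CommutativeRing)
open import Data.Nat using (ℕ; zero; suc; _≤_; _∸_)
open import Data.Fin using (Fin; zero; suc; _↑ˡ_; _↑ʳ_; splitAt)
import Data.Fin.Properties as FinP
open import Data.Fin.Subset using (Subset; ∣_∣)
open import Data.Bool using (Bool; true; false; _∧_; _∨_; _xor_)
open import Data.List using (List; []; _∷_; _++_; map; foldr; allFin; length; filterᵇ)
open import Data.Bool.ListAction using (any; all)
open import Data.Vec using (Vec; []; _∷_; lookup)
open import Data.Product using (_×_; _,_; proj₁; proj₂; ∃; ∃₂; map₁; map₂)
import Data.Product as Prod
open import Data.Sum using ([_,_]′)
open import Data.Empty using (⊥)
open import Relation.Nullary using (¬_; does)
open import Relation.Binary.PropositionalEquality using (_≡_)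

-- Vertex set of a two-terminal graph: the source s (= src), the sink
-- t (= snk, distinct from src), and k further ("inner") vertices.
-- Every two-terminal graph is isomorphic to one of this form.

data Vtx (k : ℕ) : Set where
  src snk : Vtx k
  inner   : Fin k → Vtx k

_==ᵥ_ : ∀ {k} → Vtx k → Vtx k → Bool
src     ==ᵥ src     = true
snk     ==ᵥ snk     = true
inner i ==ᵥ inner j = does (i FinP.≟ j)
_       ==ᵥ _       = false

vertices : (k : ℕ) → List (Vtx k)
vertices k = src ∷ snk ∷ map inner (allFin k)

record TwoTerminal : Set where
  field
    k    : ℕ
    m    : ℕ
    ends : Fin m → Vtx k × Vtx k
open TwoTerminal public

allSubsets : (m : ℕ) → List (Subset m)
allSubsets zero    = [] ∷ []
allSubsets (suc m) = map (false ∷_) (allSubsets m) ++ map (true ∷_) (allSubsets m)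

module _ (G : TwoTerminal) where

  step : Subset (m G) → (Vtx (k G) → Bool) → Vtx (k G) → Bool
  step A R v = R v ∨ any (λ e → lookup A e ∧
                 ((R (proj₁ (ends G e)) ∧ (proj₂ (ends G e) ==ᵥ v))
                 ∨ (R (proj₂ (ends G e)) ∧ (proj₁ (ends G e) ==ᵥ v))))
               (allFin (m G))

  walkWithin : ℕ → Subset (m G) → Vtx (k G) → Vtx (k G) → Bool
  walkWithin zero    A u v = u ==ᵥ v
  walkWithin (suc j) A u v = step A (walkWithin j A u) v

  -- there is a path from u to v in (V,A)  (a path has length < |V| = 2 + k)
  hasPath : Subset (m G) → Vtx (k G) → Vtx (k G) → Bool
  hasPath A u v = walkWithin (suc (suc (k G))) A u v

  connected : Subset (m G) → Bool
  connected A = all (λ u → all (λ v → hasPath A u v) (vertices (k G))) (vertices (k G))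

  stSplit : Subset (m G) → Bool
  stSplit A = all (λ v → hasPath A v src xor hasPath A v snk) (vertices (k G))

private
  mapPair : ∀ {a b} {A : Set a} {B : Set b} → (A → B) → A × A → B × B
  mapPair f (x , y) = f x , f y

_∥_ : TwoTerminal → TwoTerminal → TwoTerminal
G₁ ∥ G₂ = record
  { k    = k₁ Data.Nat.+ k₂
  ; m    = m G₁ Data.Nat.+ m G₂
  ; ends = λ e → [ (λ e₁ → mapPair emb₁ (ends G₁ e₁))
                 , (λ e₂ → mapPair emb₂ (ends G₂ e₂)) ]′ (splitAt (m G₁) e)
  }
  where
  k₁ = k G₁
  k₂ = k G₂
  emb₁ : Vtx k₁ → Vtx (k₁ Data.Nat.+ k₂)
  emb₁ src       = src
  emb₁ snk       = snk
  emb₁ (inner i) = inner (i ↑ˡ k₂)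
  emb₂ : Vtx k₂ → Vtx (k₁ Data.Nat.+ k₂)
  emb₂ src       = src
  emb₂ snk       = snk
  emb₂ (inner j) = inner (k₁ ↑ʳ j)

_⋈_ : TwoTerminal → TwoTerminal → TwoTerminal
G₁ ⋈ G₂ = record
  { k    = k₁ Data.Nat.+ suc k₂
  ; m    = m G₁ Data.Nat.+ m G₂
  ; ends = λ e → [ (λ e₁ → mapPair emb₁ (ends G₁ e₁))
                 , (λ e₂ → mapPair emb₂ (ends G₂ e₂)) ]′ (splitAt (m G₁) e)
  }
  where
  k₁ = k G₁
  k₂ = k G₂
  mid : Vtx (k₁ Data.Nat.+ suc k₂)
  mid = inner (k₁ ↑ʳ zero)
  emb₁ : Vtx k₁ → Vtx (k₁ Data.Nat.+ suc k₂)
  emb₁ src       = src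
  emb₁ snk       = mid
  emb₁ (inner i) = inner (i ↑ˡ suc k₂)
  emb₂ : Vtx k₂ → Vtx (k₁ Data.Nat.+ suc k₂)
  emb₂ src       = mid
  emb₂ snk       = snk
  emb₂ (inner j) = inner (k₁ ↑ʳ suc j)

-- Field-dependent part: polynomials, rational functions, the Riemann
-- sphere K ∪ {∞}.  K plays the role of ℂ.

module Over {c ℓ} (K : CommutativeRing c ℓ) where
  open CommutativeRing K

  -- polynomials in p: coefficient lists, lowest degree first
  Poly : Set c
  Poly = List Carrier

  _+ₚ_ : Poly → Poly → Poly
  []       +ₚ q        = q
  (a ∷ p)  +ₚ []       = a ∷ p
  (a ∷ p)  +ₚ (b ∷ q)  = (a + b) ∷ (p +ₚ q)

  scaleₚ : Carrier → Poly → Poly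
  scaleₚ a = map (a *_)

  _*ₚ_ : Poly → Poly → Poly
  []      *ₚ q = []
  (a ∷ p) *ₚ q = scaleₚ a q +ₚ (0# ∷ (p *ₚ q))

  constₚ : Carrier → Poly
  constₚ a = a ∷ []

  Xₚ : Poly
  Xₚ = 0# ∷ 1# ∷ []

  -ₚ_ : Poly → Poly
  -ₚ p = map -_ p

  _^ₚ_ : Poly → ℕ → Poly
  p ^ₚ zero  = constₚ 1#
  p ^ₚ suc n = p *ₚ (p ^ₚ n)

  sumₚ : List Poly → Poly
  sumₚ = foldr _+ₚ_ []

  coeff : Poly → ℕ → Carrier
  coeff []      n       = 0#
  coeff (a ∷ p) zero    = a
  coeff (a ∷ p) (suc n) = coeff p n

  eval : Poly → Carrier → Carrier
  eval []      x = 0#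
  eval (a ∷ p) x = a + x * eval p x

  -- equality of polynomials (coefficientwise, trailing zeros ignored)
  _≈ₚ_ : Poly → Poly → Set ℓ
  p ≈ₚ q = ∀ i → coeff p i ≈ coeff q i

  natK : ℕ → Carrier
  natK zero    = 0#
  natK (suc n) = 1# + natK n

  record IsACF0 : Set (c ⊔ ℓ) where
    field
      1≉0       : ¬ (1# ≈ 0#)
      inverse   : ∀ x → ¬ (x ≈ 0#) → ∃ λ y → x * y ≈ 1#
      char0     : ∀ n → ¬ (natK (suc n) ≈ 0#)
      algClosed : ∀ (a : Carrier) (as : List Carrier) →
                  ∃ λ x → eval (a ∷ as ++ (1# ∷ [])) x ≈ 0#

  record RatFun : Set c where
    constructor _/ᵣ_
    field
      num den : Poly
  open RatFun public

  _≈ᵣ_ : RatFun → RatFun → Set ℓ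
  f ≈ᵣ g = (num f *ₚ den g) ≈ₚ (num g *ₚ den f)

  _+ᵣ_ : RatFun → RatFun → RatFun
  f +ᵣ g = ((num f *ₚ den g) +ₚ (num g *ₚ den f)) /ᵣ (den f *ₚ den g)

  _*ᵣ_ : RatFun → RatFun → RatFun
  f *ᵣ g = (num f *ₚ num g) /ᵣ (den f *ₚ den g)

  -ᵣ_ : RatFun → RatFun
  -ᵣ f = (-ₚ num f) /ᵣ den f

  _-ᵣ_ : RatFun → RatFun → RatFun
  f -ᵣ g = f +ᵣ (-ᵣ g)

  1ᵣ : RatFun
  1ᵣ = constₚ 1# /ᵣ constₚ 1#

  data Ĉ : Set c where
    fin : Carrier → Ĉ
    ∞   : Ĉ

  IsZeroĈ : Ĉ → Set ℓ
  IsZeroĈ (fin a) = a ≈ 0#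
  IsZeroĈ ∞       = Lift ℓ ⊥

  -- extended arithmetic; ∞ + ∞ and 0 · ∞ are undefined in Ĉ and are given
  -- arbitrary values here (they are excluded by the hypotheses of the lemma)
  _+̂_ : Ĉ → Ĉ → Ĉ
  fin a +̂ fin b = fin (a + b)
  fin a +̂ ∞     = ∞
  ∞     +̂ w     = ∞

  -̂_ : Ĉ → Ĉ
  -̂ fin a = fin (- a)
  -̂ ∞     = ∞

  _-̂_ : Ĉ → Ĉ → Ĉ
  v -̂ w = v +̂ (-̂ w)

  1̂ : Ĉ
  1̂ = fin 1#

  _*̂_ : Ĉ → Ĉ → Ĉ
  fin a *̂ fin b = fin (a * b)
  fin a *̂ ∞     = ∞
  ∞     *̂ w     = ∞

  -- the fraction a/b (with (a,b) ≠ (0,0)) equals v ∈ Ĉ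
  FracIs : Carrier → Carrier → Ĉ → Set ℓ
  FracIs a b (fin v) = ¬ (b ≈ 0#) × (a ≈ v * b)
  FracIs a b ∞       = ¬ (a ≈ 0#) × (b ≈ 0#)

  Represents : Poly → Poly → RatFun → Set ℓ
  Represents P Q f = (P *ₚ den f) ≈ₚ (num f *ₚ Q)

  -- f(p₀) = v : for some representation P/Q of f, the quotient
  -- P(p₀)/Q(p₀) is not 0/0 and equals v.  At p₀ = ∞ one uses
  -- (P(p)/p^d)/(Q(p)/p^d) at p = ∞, i.e. the degree-d coefficients,
  -- for any d ≥ deg P, deg Q.
  HasValue : RatFun → Ĉ → Ĉ → Set (c ⊔ ℓ)
  HasValue f (fin x) v = ∃₂ λ P Q → Represents P Q f × FracIs (eval P x) (eval Q x) v
  HasValue f ∞       v = ∃₂ λ P Q → Represents P Q f ×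
                           ∃ λ d → length P ≤ suc d × length Q ≤ suc d ×
                           FracIs (coeff P d) (coeff Q d) v

  weight : (m : ℕ) → Subset m → Poly
  weight m A = ((constₚ 1# +ₚ (-ₚ Xₚ)) ^ₚ ∣ A ∣) *ₚ (Xₚ ^ₚ (m ∸ ∣ A ∣))

  R : TwoTerminal → Poly
  R G = sumₚ (map (weight (m G)) (filterᵇ (connected G) (allSubsets (m G))))

  S : TwoTerminal → Poly
  S G = sumₚ (map (weight (m G)) (filterᵇ (stSplit G) (allSubsets (m G))))

  -- y_G = (1-p) S/R + 1 = ((1-p) S + R) / R
  y : TwoTerminal → RatFun
  y G = (((constₚ 1# +ₚ (-ₚ Xₚ)) *ₚ S G) +ₚ R G) /ᵣ R G

  -- ŷ_G = R/S + 1 = (R + S) / S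
  ŷ : TwoTerminal → RatFun
  ŷ G = (R G +ₚ S G) /ᵣ S G

open Over public
  using (Poly; IsACF0; RatFun; num; den; Ĉ; fin; ∞; R; S; y; ŷ; 1ᵣ; 1̂; IsZeroĈ; HasValue)

module _ {c ℓ} {K : CommutativeRing c ℓ} where
  open Over K public
    using (_≈ᵣ_; _+ᵣ_; _*ᵣ_; -ᵣ_; _-ᵣ_; _+̂_; -̂_; _-̂_; _*̂_)

-- Cut an edge set A of G₁ ⋈ G₂ or G₁ ∥ G₂ into its parts A₁, A₂. Writing α for "every vertex
-- reaches a terminal" and β for "s reaches t", a spanning subgraph is connected iff α ∧ β and an
-- s-t split iff α ∧ ¬β. For the series composition α = α₁ α₂ (β₁ ∨ β₂) and β = β₁ β₂, for the
-- parallel one α = α₁ α₂ and β = β₁ ∨ β₂. As the weight (1-p)^|A| p^(|E|-|A|) is multiplicative,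
-- R⋈ = R₁R₂, S⋈ = R₁S₂ + S₁R₂, R∥ = R₁R₂ + R₁S₂ + S₁R₂ and S∥ = S₁S₂, which give both identities.
-- For the values at p₀, fractions P₁/Q₁ and P₂/Q₂ representing the two parts combine to
-- (P₁Q₂ + Q₁P₂ - Q₁Q₂)/(Q₁Q₂), resp. P₁P₂/(Q₁Q₂), representing the composite; evaluated at p₀
-- (at ∞: the top coefficients) this is not 0/0 outside the excluded cases ∞ + ∞ and 0 · ∞.

module Submission where

open import Algebra.Bundles using (CommutativeRing)
open import Data.Bool using (Bool; true; false; T; not; _∧_; _∨_; _xor_; if_then_else_)
import Data.Bool.Properties as Bool
open import Data.Bool.Properties using (T-∧; T-∨; T-≡; T-not-≡; T?; ∧-identityʳ; ∧-zeroʳ; ∨-identityʳ; ∨-zeroʳ)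
open import Data.Bool.ListAction using (all; and; or)
open import Data.Empty using (⊥-elim)
open import Data.Fin using (Fin; zero; suc; _↑ˡ_; _↑ʳ_; splitAt)
import Data.Fin.Properties as FinP
open import Data.Fin.Subset using (Subset; ∣_∣)
open import Data.Fin.Subset.Properties using (∣p∣≤n)
open import Data.List using (List; []; _∷_; map; allFin; length; filterᵇ) renaming (_++_ to _++ˡ_)
open import Data.List.Membership.Propositional using (_∈_; lose; find)
open import Data.List.Membership.Propositional.Properties using (∈-map⁺; ∈-allFin)
open import Data.List.Properties using (length-map; length-tabulate; map-cong)
open import Data.List.Relation.Unary.All as All using (All)
open import Data.List.Relation.Unary.All.Properties using (¬Any⇒All¬; all⁺; all⁻)
open import Data.List.Relation.Unary.Any as Any using (Any; here; there; any?)
open import Data.List.Relation.Unary.Any.Properties using (any⁺; any⁻)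
open import Data.Nat using (ℕ; zero; suc; _≤_; z≤n; s≤s; _∸_) renaming (_+_ to _+ℕ_)
open import Data.Nat.Properties using (≤-trans; m≤n+m; +-∸-assoc)
open import Data.Product as Prod using (_×_; _,_; proj₁; proj₂; ∃)
open import Data.Sum using (_⊎_; inj₁; inj₂; [_,_]′)
open import Data.Unit using (tt)
open import Data.Vec using (lookup; _++_)
open import Data.Vec.Properties using (lookup-++ˡ; lookup-++ʳ)
open import Function.Base using (id; _∘_)
open import Function.Bundles using (Equivalence)
open import Relation.Binary.Construct.Closure.ReflexiveTransitive using (Star; ε; _◅_; _◅◅_; foldl; gfold; gmap; reverse)
open import Relation.Binary.PropositionalEquality as ≡ using (_≡_)
open import Relation.Nullary using (¬_; yes; no)
open import Relation.Nullary.Decidable using (Dec; True; toWitness; map′; ¬?; _×-dec_; decidable-stable; dec-true)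
open import Relation.Unary using (Decidable)

open import Defs

open Equivalence using (to; from)

module Connectivity where
  open import Data.Nat using (_+_)
  open import Data.Nat.Properties using (m≤n⇒m≤1+n; +-suc; +-comm; ≤-total; m≤n⇒∃[o]m+o≡n; 1+n≰n)
  open import Relation.Binary.PropositionalEquality

  T-ext : ∀ {a b} → (T a → T b) → (T b → T a) → a ≡ b
  T-ext {false} {false} _ _ = refl
  T-ext {false} {true}  _ g = ⊥-elim (g tt)
  T-ext {true}  {false} f _ = ⊥-elim (f tt)
  T-ext {true}  {true}  _ _ = refl

  T-not⁺ : ∀ {b} → ¬ T b → T (not b)
  T-not⁺ {true}  ¬b = ¬b tt
  T-not⁺ {false} _  = tt

  T-not⁻ : ∀ {b} → T (not b) → ¬ T b
  T-not⁻ {false} _ ()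

  xor⇒∨ : ∀ {a b} → T (a xor b) → T (a ∨ b)
  xor⇒∨ {true}  t = tt
  xor⇒∨ {false} t = t

  xor⇒¬both : ∀ {a b} → T (a xor b) → ¬ (T a × T b)
  xor⇒¬both {true} {true} () _

  one-of⇒xor : ∀ {a b} → T (a ∨ b) → ¬ (T a × T b) → T (a xor b)
  one-of⇒xor {true}  {true}  _ both = both (tt , tt)
  one-of⇒xor {true}  {false} _ _    = tt
  one-of⇒xor {false} {true}  _ _    = tt

  all-cong : ∀ {V : Set} {f g : V → Bool} → (∀ v → f v ≡ g v) → ∀ xs → all f xs ≡ all g xs
  all-cong f≗g xs = cong and (map-cong f≗g xs)

  ∀-Bool? : {P : Bool → Set} → Decidable P → Dec (∀ b → P b)
  ∀-Bool? P? = map′ (λ (t , f) → λ { true → t ; false → f }) (λ h → h true , h false) (P? true ×-dec P? false)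

  by-truth-table : {f g : Bool → Bool → Bool → Bool → Bool} →
    {ok : True (∀-Bool? λ a → ∀-Bool? λ b → ∀-Bool? λ c → ∀-Bool? λ d → f a b c d Bool.≟ g a b c d)} →
    ∀ a b c d → f a b c d ≡ g a b c d
  by-truth-table {ok = ok} = toWitness ok

  count : ∀ {V : Set} → (V → Bool) → List V → ℕ
  count f []       = 0
  count f (x ∷ xs) with f x
  ... | true  = suc (count f xs)
  ... | false = count f xs

  count≤length : ∀ {V : Set} (f : V → Bool) xs → count f xs ≤ length xs
  count≤length f []       = z≤n
  count≤length f (x ∷ xs) with f x
  ... | true  = s≤s (count≤length f xs)
  ... | false = m≤n⇒m≤1+n (count≤length f xs)

  _⊆ᵇ_ : ∀ {V : Set} → (V → Bool) → (V → Bool) → Set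
  f ⊆ᵇ g = ∀ {x} → T (f x) → T (g x)

  count-mono : ∀ {V : Set} {f g : V → Bool} → f ⊆ᵇ g → ∀ xs → count f xs ≤ count g xs
  count-mono {f = f} {g} f⊆g []       = z≤n
  count-mono {f = f} {g} f⊆g (x ∷ xs) with f x in fx | g x in gx
  ... | true  | true  = s≤s (count-mono f⊆g xs)
  ... | false | true  = m≤n⇒m≤1+n (count-mono f⊆g xs)
  ... | false | false = count-mono f⊆g xs
  ... | true  | false = ⊥-elim (subst T gx (f⊆g (subst T (sym fx) tt)))

  count-strict : ∀ {V : Set} {f g : V → Bool} → f ⊆ᵇ g → ∀ {x} xs → x ∈ xs →
                 ¬ T (f x) → T (g x) → suc (count f xs) ≤ count g xs
  count-strict {f = f} {g} f⊆g (y ∷ ys) (here refl) ¬fx gx with f y | g y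
  ... | true  | _     = ⊥-elim (¬fx tt)
  ... | false | true  = s≤s (count-mono f⊆g ys)
  count-strict {f = f} {g} f⊆g (y ∷ ys) (there x∈ys) ¬fx gx with f y in fy | g y in gy
  ... | true  | true  = s≤s (count-strict f⊆g ys x∈ys ¬fx gx)
  ... | false | true  = m≤n⇒m≤1+n (count-strict f⊆g ys x∈ys ¬fx gx)
  ... | false | false = count-strict f⊆g ys x∈ys ¬fx gx
  ... | true  | false = ⊥-elim (subst T gy (f⊆g (subst T (sym fy) tt)))

  count-pos : ∀ {V : Set} (f : V → Bool) {x} xs → x ∈ xs → T (f x) → 1 ≤ count f xs
  count-pos f (y ∷ ys) (here refl) fx with f y
  ... | true = s≤s z≤n
  count-pos f (y ∷ ys) (there x∈ys) fx with f y
  ... | true  = s≤s z≤n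
  ... | false = count-pos f ys x∈ys fx

  -- hasPath only inspects walks of length at most |V|; by then the walk relation has stabilised.
  module Saturation {V : Set} (vs : List V) (complete : ∀ v → v ∈ vs)
                    (F : ℕ → V → Bool) (v₀ : V) (F-base : T (F 0 v₀))
                    (F-grows : ∀ j → F j ⊆ᵇ F (suc j))
                    (F-next : ∀ i j → (∀ v → F i v ≡ F j v) → ∀ v → F (suc i) v ≡ F (suc j) v)
                    where

    StableFrom : ℕ → Set
    StableFrom j = ∀ t v → F (t + j) v ≡ F j v

    stable-from : ∀ j → (∀ v → F (suc j) v ≡ F j v) → StableFrom j
    stable-from j same zero    v = refl
    stable-from j same (suc t) v = trans (F-next (t + j) j (stable-from j same t) v) (same v)

    stable-suc : ∀ j → StableFrom j → StableFrom (suc j)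
    stable-suc j st t v = trans (subst (λ n → F n v ≡ F j v) (sym (+-suc t j)) (st (suc t) v)) (sym (st 1 v))

    grows-or-stable : ∀ j → suc j ≤ count (F j) vs ⊎ StableFrom j
    grows-or-stable zero    = inj₁ (count-pos (F 0) vs (complete v₀) F-base)
    grows-or-stable (suc j) with grows-or-stable j
    ... | inj₂ st = inj₂ (stable-suc j st)
    ... | inj₁ big with any? (λ x → T? (F (suc j) x) ×-dec ¬? (T? (F j x))) vs
    ...   | yes new = let x , x∈vs , (new-x , ¬old-x) = find new in
              inj₁ (≤-trans (s≤s big) (count-strict (F-grows j) vs x∈vs ¬old-x new-x))
    ...   | no ¬new = inj₂ (stable-suc j (stable-from j same))
      where
      same : ∀ v → F (suc j) v ≡ F j v
      same v = T-ext (λ new-v → decidable-stable (T? (F j v))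
                                 (λ ¬old-v → All.lookup (¬Any⇒All¬ vs ¬new) (complete v) (new-v , ¬old-v)))
                     (F-grows j)

    saturated : StableFrom (length vs)
    saturated with grows-or-stable (length vs)
    ... | inj₂ st  = st
    ... | inj₁ big = ⊥-elim (1+n≰n (≤-trans big (count≤length (F (length vs)) vs)))

    grows-by : ∀ d n → F n ⊆ᵇ F (d + n)
    grows-by zero    n = id
    grows-by (suc d) n = F-grows (d + n) ∘ grows-by d n

    saturate : ∀ n → F n ⊆ᵇ F (length vs)
    saturate n {v} Fnv with ≤-total n (length vs)
    ... | inj₁ n≤N = let d , n+d≡N = m≤n⇒∃[o]m+o≡n n≤N in
        subst (λ j → T (F j v)) (trans (+-comm d n) n+d≡N) (grows-by d n Fnv)
    ... | inj₂ N≤n = let d , N+d≡n = m≤n⇒∃[o]m+o≡n N≤n in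
        subst T (saturated d v) (subst (λ j → T (F j v)) (sym (trans (+-comm d _) N+d≡n)) Fnv)

  ==ᵥ-refl : ∀ {k} (v : Vtx k) → T (v ==ᵥ v)
  ==ᵥ-refl src       = tt
  ==ᵥ-refl snk       = tt
  ==ᵥ-refl (inner i) = subst T (sym (dec-true (i FinP.≟ i) refl)) tt

  ==ᵥ⇒≡ : ∀ {k} {u v : Vtx k} → T (u ==ᵥ v) → u ≡ v
  ==ᵥ⇒≡ {u = src}     {src}     _ = refl
  ==ᵥ⇒≡ {u = snk}     {snk}     _ = refl
  ==ᵥ⇒≡ {u = inner i} {inner j} t with i FinP.≟ j
  ... | yes i≡j = cong inner i≡j
  ==ᵥ⇒≡ {u = src}     {snk}     ()
  ==ᵥ⇒≡ {u = src}     {inner _} ()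
  ==ᵥ⇒≡ {u = snk}     {src}     ()
  ==ᵥ⇒≡ {u = snk}     {inner _} ()
  ==ᵥ⇒≡ {u = inner _} {src}     ()
  ==ᵥ⇒≡ {u = inner _} {snk}     ()

  ∈-vertices : ∀ {k} (v : Vtx k) → v ∈ vertices k
  ∈-vertices src       = here refl
  ∈-vertices snk       = there (here refl)
  ∈-vertices (inner i) = there (there (∈-map⁺ inner (∈-allFin i)))

  length-vertices : ∀ k → length (vertices k) ≡ suc (suc k)
  length-vertices k = cong (λ n → suc (suc n)) (trans (length-map inner (allFin k)) (length-tabulate id))

  Joins : ∀ {k} → Vtx k → Vtx k → Vtx k × Vtx k → Set
  Joins x y (u , v) = (u ≡ x × v ≡ y) ⊎ (v ≡ x × u ≡ y)

  module _ (G : TwoTerminal) (A : Subset (m G)) where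

    Adjacent : Vtx (k G) → Vtx (k G) → Set
    Adjacent x y = ∃ λ e → T (lookup A e) × Joins x y (ends G e)

    Reachable : Vtx (k G) → Vtx (k G) → Set
    Reachable = Star Adjacent

    adjacent-sym : ∀ {x y} → Adjacent x y → Adjacent y x
    adjacent-sym (e , a , inj₁ (p , q)) = e , a , inj₂ (q , p)
    adjacent-sym (e , a , inj₂ (p , q)) = e , a , inj₁ (q , p)

    reachable-sym : ∀ {x y} → Reachable x y → Reachable y x
    reachable-sym = reverse adjacent-sym

    step-adjacent : ∀ f {x y} → T (f x) → Adjacent x y → T (step G A f y)
    step-adjacent f {y = y} fx (e , a , joins) =
      from T-∨ (inj₂ (any⁺ _ (lose (∈-allFin e) (from T-∧ (a , along joins)))))
      where
      along : Joins _ y (ends G e) → T ((f (proj₁ (ends G e)) ∧ (proj₂ (ends G e) ==ᵥ y))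
                                        ∨ (f (proj₂ (ends G e)) ∧ (proj₁ (ends G e) ==ᵥ y)))
      along (inj₁ (refl , refl)) = from T-∨ (inj₁ (from T-∧ (fx , ==ᵥ-refl y)))
      along (inj₂ (refl , refl)) = from T-∨ (inj₂ (from T-∧ (fx , ==ᵥ-refl y)))

    step-inversion : ∀ f {y} → T (step G A f y) → T (f y) ⊎ ∃ λ x → T (f x) × Adjacent x y
    step-inversion f t with to T-∨ t
    ... | inj₁ fy = inj₁ fy
    ... | inj₂ t′ with Any.satisfied (any⁻ _ (allFin (m G)) t′)
    ...   | e , t″ with to T-∧ t″
    ...     | a , t‴ with to T-∨ t‴
    ...       | inj₁ t₁ = let fx , eq = to T-∧ t₁ in inj₂ (_ , fx , e , a , inj₁ (refl , ==ᵥ⇒≡ eq))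
    ...       | inj₂ t₂ = let fx , eq = to T-∧ t₂ in inj₂ (_ , fx , e , a , inj₂ (refl , ==ᵥ⇒≡ eq))

    walk⇒reachable : ∀ n {u v} → T (walkWithin G n A u v) → Reachable u v
    walk⇒reachable zero    {u} t = subst (Reachable u) (==ᵥ⇒≡ t) ε
    walk⇒reachable (suc n) {u} {v} t with step-inversion (walkWithin G n A u) {v} t
    ... | inj₁ t′           = walk⇒reachable n t′
    ... | inj₂ (_ , t′ , a) = walk⇒reachable n t′ ◅◅ (a ◅ ε)

    reachable⇒walk : ∀ {u v} → Reachable u v → ∃ λ n → T (walkWithin G n A u v)
    reachable⇒walk = foldl (λ u v → ∃ λ n → T (walkWithin G n A u v))
                               (λ (n , t) a → suc n , step-adjacent _ t a)
                               (λ {x} → zero , ==ᵥ-refl x)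

    step-cong : ∀ {f g} → (∀ v → f v ≡ g v) → ∀ v → step G A f v ≡ step G A g v
    step-cong {f} {g} f≗g v = cong₂ _∨_ (f≗g v) (cong or (map-cong (λ e →
      cong₂ (λ a b → lookup A e ∧ ((a ∧ (proj₂ (ends G e) ==ᵥ v)) ∨ (b ∧ (proj₁ (ends G e) ==ᵥ v))))
            (f≗g (proj₁ (ends G e))) (f≗g (proj₂ (ends G e)))) (allFin (m G))))

    hasPath⇒reachable : ∀ {u v} → T (hasPath G A u v) → Reachable u v
    hasPath⇒reachable = walk⇒reachable (suc (suc (k G)))

    reachable⇒hasPath : ∀ {u v} → Reachable u v → T (hasPath G A u v)
    reachable⇒hasPath {u} {v} r with reachable⇒walk r
    ... | n , walk = subst (λ N → T (walkWithin G N A u v)) (length-vertices (k G)) (saturate n walk)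
      where
      open Saturation (vertices (k G)) ∈-vertices (λ j → walkWithin G j A u) u (==ᵥ-refl u)
                      (λ j → from T-∨ ∘ inj₁) (λ i j → step-cong)

    hasPath-sym : ∀ x y → hasPath G A x y ≡ hasPath G A y x
    hasPath-sym x y = T-ext (flip-path x y) (flip-path y x)
      where
      flip-path : ∀ x y → T (hasPath G A x y) → T (hasPath G A y x)
      flip-path x y p = reachable⇒hasPath (reachable-sym (hasPath⇒reachable p))

    Invariant : ∀ {ℓ} {B : Set ℓ} → (Vtx (k G) → B) → Set ℓ
    Invariant f = ∀ {x y} → Adjacent x y → f x ≡ f y

    invariant-along : ∀ {ℓ} {B : Set ℓ} {f : Vtx (k G) → B} → Invariant f → ∀ {x y} → Reachable x y → f x ≡ f y
    invariant-along {f = f} inv = foldl (λ x y → f x ≡ f y) (λ eq a → trans eq (inv a)) refl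

    hasPath-invariant : ∀ z → Invariant (λ x → hasPath G A x z)
    hasPath-invariant z a = T-ext (λ p → reachable⇒hasPath (adjacent-sym a ◅ hasPath⇒reachable p))
                                  (λ p → reachable⇒hasPath (a ◅ hasPath⇒reachable p))

  module _ {G G′ : TwoTerminal} {A : Subset (m G)} {A′ : Subset (m G′)} (r : Vtx (k G) → Vtx (k G′))
           (adjacent-contract : ∀ {x y} → Adjacent G A x y → Adjacent G′ A′ (r x) (r y) ⊎ r x ≡ r y) where

    reachable-contract : ∀ {x y} → Reachable G A x y → Reachable G′ A′ (r x) (r y)
    reachable-contract = gfold r (Reachable G′ A′) extend ε
      where
      extend : ∀ {x y z} → Adjacent G A x y → Reachable G′ A′ (r y) z → Reachable G′ A′ (r x) z
      extend a rest with adjacent-contract a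
      ... | inj₁ a′ = a′ ◅ rest
      ... | inj₂ eq = subst (λ v → Reachable G′ A′ v _) (sym eq) rest

  allVertices⁺ : ∀ {k} (p : Vtx k → Bool) → T (all p (vertices k)) → ∀ v → T (p v)
  allVertices⁺ p t v = All.lookup (all⁺ p _ t) (∈-vertices v)

  allVertices⁻ : ∀ {k} (p : Vtx k → Bool) → (∀ v → T (p v)) → T (all p (vertices k))
  allVertices⁻ {k} p f = all⁻ p {xs = vertices k} (All.tabulate (λ {v} _ → f v))

  module _ (G : TwoTerminal) (A : Subset (m G)) where
    private
      _⇝_ : Vtx (k G) → Vtx (k G) → Bool
      x ⇝ y = hasPath G A x y
      ⇝⁺ : ∀ {x y} → Reachable G A x y → T (x ⇝ y)
      ⇝⁺ = reachable⇒hasPath G A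
      ⇝⁻ : ∀ {x y} → T (x ⇝ y) → Reachable G A x y
      ⇝⁻ = hasPath⇒reachable G A

    reachesTerminal : Vtx (k G) → Bool
    reachesTerminal v = (v ⇝ src) ∨ (v ⇝ snk)

    anchored : Bool
    anchored = all reachesTerminal (vertices (k G))

    linked : Bool
    linked = src ⇝ snk

    private
      reaches-src : T anchored → T linked → ∀ v → Reachable G A v src
      reaches-src anc lnk v with to (T-∨ {v ⇝ src}) (allVertices⁺ reachesTerminal anc v)
      ... | inj₁ v⇝src = ⇝⁻ v⇝src
      ... | inj₂ v⇝snk = ⇝⁻ v⇝snk ◅◅ reachable-sym G A (⇝⁻ lnk)

    all-reach≡anchored∧linked : ∀ t → all (_⇝ t) (vertices (k G)) ≡ anchored ∧ linked
    all-reach≡anchored∧linked t = T-ext all-reach⇒ ⇒all-reach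
      where
      all-reach⇒ : T (all (_⇝ t) (vertices (k G))) → T (anchored ∧ linked)
      all-reach⇒ all-t = from T-∧ ( allVertices⁻ reachesTerminal (λ v → from T-∨ (inj₁ (⇝⁺ (via-t v src))))
                                  , ⇝⁺ (via-t src snk))
        where
        via-t : ∀ x y → Reachable G A x y
        via-t x y = ⇝⁻ (allVertices⁺ (_⇝ t) all-t x) ◅◅ reachable-sym G A (⇝⁻ (allVertices⁺ (_⇝ t) all-t y))
      ⇒all-reach : T (anchored ∧ linked) → T (all (_⇝ t) (vertices (k G)))
      ⇒all-reach al = allVertices⁻ (_⇝ t) (λ v → ⇝⁺ (to-src v ◅◅ reachable-sym G A (to-src t)))
        where
        to-src : ∀ v → Reachable G A v src
        to-src = reaches-src (proj₁ (to T-∧ al)) (proj₂ (to T-∧ al))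

    connected≡anchored∧linked : connected G A ≡ anchored ∧ linked
    connected≡anchored∧linked = trans (T-ext conn⇒ ⇒conn) (all-reach≡anchored∧linked src)
      where
      row : Vtx (k G) → Bool
      row u = all (u ⇝_) (vertices (k G))
      conn⇒ : T (connected G A) → T (all (_⇝ src) (vertices (k G)))
      conn⇒ c = allVertices⁻ (_⇝ src) (λ v → allVertices⁺ (v ⇝_) (allVertices⁺ row c v) src)
      ⇒conn : T (all (_⇝ src) (vertices (k G))) → T (connected G A)
      ⇒conn r = allVertices⁻ row (λ u → allVertices⁻ (u ⇝_) (λ v →
                  ⇝⁺ (⇝⁻ (allVertices⁺ (_⇝ src) r u) ◅◅ reachable-sym G A (⇝⁻ (allVertices⁺ (_⇝ src) r v)))))

    reachesTerminal-invariant : Invariant G A reachesTerminal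
    reachesTerminal-invariant a = cong₂ _∨_ (hasPath-invariant G A src a) (hasPath-invariant G A snk a)

    reachesTerminal-src : reachesTerminal src ≡ true
    reachesTerminal-src = T-ext (λ _ → tt) (λ _ → from T-∨ (inj₁ (⇝⁺ ε)))

    reachesTerminal-snk : reachesTerminal snk ≡ true
    reachesTerminal-snk = T-ext (λ _ → tt) (λ _ → from (T-∨ {snk ⇝ src}) (inj₂ (⇝⁺ ε)))

    anchored-unless-snk : ∀ c → all (λ v → (v ⇝ src) ∨ ((v ⇝ snk) ∧ c)) (vertices (k G)) ≡ anchored ∧ (linked ∨ c)
    anchored-unless-snk true  = trans (all-cong (λ v → cong ((v ⇝ src) ∨_) (∧-identityʳ (v ⇝ snk))) (vertices (k G)))
                                      (sym (trans (cong (anchored ∧_) (∨-zeroʳ linked)) (∧-identityʳ anchored)))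
    anchored-unless-snk false =
      trans (all-cong (λ v → trans (cong ((v ⇝ src) ∨_) (∧-zeroʳ (v ⇝ snk))) (∨-identityʳ (v ⇝ src))) (vertices (k G)))
                                      (trans (all-reach≡anchored∧linked src) (cong (anchored ∧_) (sym (∨-identityʳ linked))))

    anchored-unless-src : ∀ c → all (λ v → ((v ⇝ src) ∧ c) ∨ (v ⇝ snk)) (vertices (k G)) ≡ anchored ∧ (linked ∨ c)
    anchored-unless-src true  = trans (all-cong (λ v → cong (_∨ (v ⇝ snk)) (∧-identityʳ (v ⇝ src))) (vertices (k G)))
                                      (sym (trans (cong (anchored ∧_) (∨-zeroʳ linked)) (∧-identityʳ anchored)))
    anchored-unless-src false = trans (all-cong (λ v → cong (_∨ (v ⇝ snk)) (∧-zeroʳ (v ⇝ src))) (vertices (k G)))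
                                      (trans (all-reach≡anchored∧linked snk) (cong (anchored ∧_) (sym (∨-identityʳ linked))))

    stSplit≡anchored∧¬linked : stSplit G A ≡ anchored ∧ not linked
    stSplit≡anchored∧¬linked = T-ext split⇒ ⇒split
      where
      separated : Vtx (k G) → Bool
      separated v = (v ⇝ src) xor (v ⇝ snk)
      split⇒ : T (stSplit G A) → T (anchored ∧ not linked)
      split⇒ s = from T-∧ ( allVertices⁻ reachesTerminal (λ v → xor⇒∨ {v ⇝ src} (allVertices⁺ separated s v))
                          , T-not⁺ (λ lnk → xor⇒¬both {src ⇝ src} (allVertices⁺ separated s src) (⇝⁺ ε , lnk)))
      ⇒split : T (anchored ∧ not linked) → T (stSplit G A)
      ⇒split al = allVertices⁻ separated (λ v → one-of⇒xor {v ⇝ src} (allVertices⁺ reachesTerminal anc v)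
                    (λ (v⇝src , v⇝snk) → ¬lnk (⇝⁺ (reachable-sym G A (⇝⁻ v⇝src) ◅◅ ⇝⁻ v⇝snk))))
        where
        anc : T anchored
        anc = proj₁ (to T-∧ al)
        ¬lnk : ¬ T linked
        ¬lnk = T-not⁻ (proj₂ (to T-∧ al))

  module Gluing (G₁ G₂ : TwoTerminal) (kH : ℕ)
                (endsH : Fin (m G₁ + m G₂) → Vtx kH × Vtx kH)
                (ι₁ : Vtx (k G₁) → Vtx kH) (ι₂ : Vtx (k G₂) → Vtx kH)
                (ends-inl : ∀ e → endsH (e ↑ˡ m G₂) ≡ Prod.map ι₁ ι₁ (ends G₁ e))
                (ends-inr : ∀ e → endsH (m G₁ ↑ʳ e) ≡ Prod.map ι₂ ι₂ (ends G₂ e))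
                (cover : ∀ x → (∃ λ a → ι₁ a ≡ x) ⊎ (∃ λ b → ι₂ b ≡ x))
                (A₁ : Subset (m G₁)) (A₂ : Subset (m G₂)) where

    H : TwoTerminal
    H = record { k = kH ; m = m G₁ + m G₂ ; ends = endsH }

    A : Subset (m H)
    A = A₁ ++ A₂

    private
      joins-map : ∀ {k k′} {f : Vtx k → Vtx k′} {x y} ends → Joins x y ends → Joins (f x) (f y) (Prod.map f f ends)
      joins-map _ (inj₁ (refl , refl)) = inj₁ (refl , refl)
      joins-map _ (inj₂ (refl , refl)) = inj₂ (refl , refl)

      joins-unmap : ∀ {k k′} {f : Vtx k → Vtx k′} {x′ y′} ends → Joins x′ y′ (Prod.map f f ends) →
                    ∃ λ x → ∃ λ y → Joins x y ends × f x ≡ x′ × f y ≡ y′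
      joins-unmap _ (inj₁ (refl , refl)) = _ , _ , inj₁ (refl , refl) , refl , refl
      joins-unmap _ (inj₂ (refl , refl)) = _ , _ , inj₂ (refl , refl) , refl , refl

    adjacent-inl : ∀ {x y} → Adjacent G₁ A₁ x y → Adjacent H A (ι₁ x) (ι₁ y)
    adjacent-inl {x} {y} (e , a , j) = e ↑ˡ m G₂ , subst T (sym (lookup-++ˡ A₁ A₂ e)) a ,
      subst (Joins (ι₁ x) (ι₁ y)) (sym (ends-inl e)) (joins-map {f = ι₁} (ends G₁ e) j)

    adjacent-inr : ∀ {x y} → Adjacent G₂ A₂ x y → Adjacent H A (ι₂ x) (ι₂ y)
    adjacent-inr {x} {y} (e , a , j) = m G₁ ↑ʳ e , subst T (sym (lookup-++ʳ A₁ A₂ e)) a ,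
      subst (Joins (ι₂ x) (ι₂ y)) (sym (ends-inr e)) (joins-map {f = ι₂} (ends G₂ e) j)

    reachable-inl : ∀ {x y} → Reachable G₁ A₁ x y → Reachable H A (ι₁ x) (ι₁ y)
    reachable-inl = gmap ι₁ adjacent-inl

    reachable-inr : ∀ {x y} → Reachable G₂ A₂ x y → Reachable H A (ι₂ x) (ι₂ y)
    reachable-inr = gmap ι₂ adjacent-inr

    hasPath-inl : ∀ {x y} → T (hasPath G₁ A₁ x y) → T (hasPath H A (ι₁ x) (ι₁ y))
    hasPath-inl = reachable⇒hasPath H A ∘ reachable-inl ∘ hasPath⇒reachable G₁ A₁

    hasPath-inr : ∀ {x y} → T (hasPath G₂ A₂ x y) → T (hasPath H A (ι₂ x) (ι₂ y))
    hasPath-inr = reachable⇒hasPath H A ∘ reachable-inr ∘ hasPath⇒reachable G₂ A₂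

    adjacent-cases : ∀ {x′ y′} → Adjacent H A x′ y′ →
      (∃ λ x → ∃ λ y → Adjacent G₁ A₁ x y × ι₁ x ≡ x′ × ι₁ y ≡ y′) ⊎
      (∃ λ x → ∃ λ y → Adjacent G₂ A₂ x y × ι₂ x ≡ x′ × ι₂ y ≡ y′)
    adjacent-cases (e , a , j) with splitAt (m G₁) e in eq
    ... | inj₁ e₁ with refl ← FinP.splitAt⁻¹-↑ˡ eq =
      let x , y , j₁ , p , q = joins-unmap {f = ι₁} (ends G₁ e₁) (subst (Joins _ _) (ends-inl e₁) j) in
      inj₁ (x , y , (e₁ , subst T (lookup-++ˡ A₁ A₂ e₁) a , j₁) , p , q)
    ... | inj₂ e₂ with refl ← FinP.splitAt⁻¹-↑ʳ eq =
      let x , y , j₂ , p , q = joins-unmap {f = ι₂} (ends G₂ e₂) (subst (Joins _ _) (ends-inr e₂) j) in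
      inj₂ (x , y , (e₂ , subst T (lookup-++ʳ A₁ A₂ e₂) a , j₂) , p , q)

    invariant-glued : ∀ {ℓ} {B : Set ℓ} (f : Vtx kH → B) →
      Invariant G₁ A₁ (f ∘ ι₁) → Invariant G₂ A₂ (f ∘ ι₂) → Invariant H A f
    invariant-glued f inv₁ inv₂ a with adjacent-cases a
    ... | inj₁ (_ , _ , a₁ , refl , refl) = inv₁ a₁
    ... | inj₂ (_ , _ , a₂ , refl , refl) = inv₂ a₂

    all-glued : ∀ (f : Vtx kH → Bool) →
      all f (vertices kH) ≡ all (f ∘ ι₁) (vertices (k G₁)) ∧ all (f ∘ ι₂) (vertices (k G₂))
    all-glued f = T-ext all⇒ ⇒all
      where
      all⇒ : T (all f (vertices kH)) → T (all (f ∘ ι₁) (vertices (k G₁)) ∧ all (f ∘ ι₂) (vertices (k G₂)))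
      all⇒ t = from T-∧ (allVertices⁻ (f ∘ ι₁) (allVertices⁺ f t ∘ ι₁) , allVertices⁻ (f ∘ ι₂) (allVertices⁺ f t ∘ ι₂))
      ⇒all : T (all (f ∘ ι₁) (vertices (k G₁)) ∧ all (f ∘ ι₂) (vertices (k G₂))) → T (all f (vertices kH))
      ⇒all t with to (T-∧ {all (f ∘ ι₁) (vertices (k G₁))}) t
      ... | all₁ , all₂ = allVertices⁻ f on
        where
        on : ∀ x → T (f x)
        on x with cover x
        ... | inj₁ (a , refl) = allVertices⁺ (f ∘ ι₁) all₁ a
        ... | inj₂ (b , refl) = allVertices⁺ (f ∘ ι₂) all₂ b

    contract-inl : (r : Vtx kH → Vtx (k G₁)) → (∀ a → r (ι₁ a) ≡ a) → (∀ b b′ → r (ι₂ b) ≡ r (ι₂ b′)) →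
                   ∀ {x y} → Reachable H A x y → Reachable G₁ A₁ (r x) (r y)
    contract-inl r retract collapse = reachable-contract {A = A} {A₁} r contract
      where
      contract : ∀ {x y} → Adjacent H A x y → Adjacent G₁ A₁ (r x) (r y) ⊎ r x ≡ r y
      contract a with adjacent-cases a
      ... | inj₁ (x , y , a₁ , refl , refl) = inj₁ (subst₂ (Adjacent G₁ A₁) (sym (retract x)) (sym (retract y)) a₁)
      ... | inj₂ (x , y , _  , refl , refl) = inj₂ (collapse x y)

    contract-inr : (r : Vtx kH → Vtx (k G₂)) → (∀ b → r (ι₂ b) ≡ b) → (∀ a a′ → r (ι₁ a) ≡ r (ι₁ a′)) →
                   ∀ {x y} → Reachable H A x y → Reachable G₂ A₂ (r x) (r y)
    contract-inr r retract collapse = reachable-contract {A = A} {A₂} r contract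
      where
      contract : ∀ {x y} → Adjacent H A x y → Adjacent G₂ A₂ (r x) (r y) ⊎ r x ≡ r y
      contract a with adjacent-cases a
      ... | inj₁ (x , y , _  , refl , refl) = inj₂ (collapse x y)
      ... | inj₂ (x , y , a₂ , refl , refl) = inj₁ (subst₂ (Adjacent G₂ A₂) (sym (retract x)) (sym (retract y)) a₂)

  -- Series composition

  series-connected-law : ∀ a₁ b₁ a₂ b₂ →
    ((a₁ ∧ (b₁ ∨ b₂)) ∧ (a₂ ∧ (b₂ ∨ b₁))) ∧ (b₁ ∧ b₂) ≡ (a₁ ∧ b₁) ∧ (a₂ ∧ b₂)
  series-connected-law = by-truth-table

  series-split-law : ∀ a₁ b₁ a₂ b₂ →
    ((a₁ ∧ (b₁ ∨ b₂)) ∧ (a₂ ∧ (b₂ ∨ b₁))) ∧ not (b₁ ∧ b₂) ≡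
    ((a₁ ∧ b₁) ∧ (a₂ ∧ not b₂)) ∨ ((a₁ ∧ not b₁) ∧ (a₂ ∧ b₂))
  series-split-law = by-truth-table

  module Series (G₁ G₂ : TwoTerminal) where
    private
      k₁ k₂ : ℕ
      k₁ = k G₁
      k₂ = k G₂

    ι₁ : Vtx k₁ → Vtx (k₁ + suc k₂)
    ι₁ src       = src
    ι₁ snk       = inner (k₁ ↑ʳ zero)
    ι₁ (inner i) = inner (i ↑ˡ suc k₂)

    ι₂ : Vtx k₂ → Vtx (k₁ + suc k₂)
    ι₂ src       = inner (k₁ ↑ʳ zero)
    ι₂ snk       = snk
    ι₂ (inner j) = inner (k₁ ↑ʳ suc j)

    -- ι₁ and ι₂ repeat the vertex embeddings local to the definition of _⋈_.
    ends-inl : ∀ e → ends (G₁ ⋈ G₂) (e ↑ˡ m G₂) ≡ Prod.map ι₁ ι₁ (ends G₁ e)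
    ends-inl e rewrite FinP.splitAt-↑ˡ (m G₁) e (m G₂) with ends G₁ e
    ... | src     , src     = refl
    ... | src     , snk     = refl
    ... | src     , inner _ = refl
    ... | snk     , src     = refl
    ... | snk     , snk     = refl
    ... | snk     , inner _ = refl
    ... | inner _ , src     = refl
    ... | inner _ , snk     = refl
    ... | inner _ , inner _ = refl

    ends-inr : ∀ e → ends (G₁ ⋈ G₂) (m G₁ ↑ʳ e) ≡ Prod.map ι₂ ι₂ (ends G₂ e)
    ends-inr e rewrite FinP.splitAt-↑ʳ (m G₁) (m G₂) e with ends G₂ e
    ... | src     , src     = refl
    ... | src     , snk     = refl
    ... | src     , inner _ = refl
    ... | snk     , src     = refl
    ... | snk     , snk     = refl
    ... | snk     , inner _ = refl
    ... | inner _ , src     = refl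
    ... | inner _ , snk     = refl
    ... | inner _ , inner _ = refl

    cover : ∀ x → (∃ λ a → ι₁ a ≡ x) ⊎ (∃ λ b → ι₂ b ≡ x)
    cover src = inj₁ (src , refl)
    cover snk = inj₂ (snk , refl)
    cover (inner i) with splitAt k₁ i in eq
    ... | inj₁ i₁      = inj₁ (inner i₁ , cong inner (FinP.splitAt⁻¹-↑ˡ eq))
    ... | inj₂ zero    = inj₁ (snk      , cong inner (FinP.splitAt⁻¹-↑ʳ eq))
    ... | inj₂ (suc j) = inj₂ (inner j  , cong inner (FinP.splitAt⁻¹-↑ʳ eq))

    -- Collapsing the other part onto the junction maps paths of G₁ ⋈ G₂ to paths of either part.
    retract₁ : Vtx (k₁ + suc k₂) → Vtx k₁
    retract₁ src       = src
    retract₁ snk       = snk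
    retract₁ (inner i) = [ inner , (λ _ → snk) ]′ (splitAt k₁ i)

    retract₂ : Vtx (k₁ + suc k₂) → Vtx k₂
    retract₂ src       = src
    retract₂ snk       = snk
    retract₂ (inner i) = [ (λ _ → src) , (λ { zero → src ; (suc j) → inner j }) ]′ (splitAt k₁ i)

    retract₁∘ι₁ : ∀ a → retract₁ (ι₁ a) ≡ a
    retract₁∘ι₁ src       = refl
    retract₁∘ι₁ snk       rewrite FinP.splitAt-↑ʳ k₁ (suc k₂) zero = refl
    retract₁∘ι₁ (inner i) rewrite FinP.splitAt-↑ˡ k₁ i (suc k₂) = refl

    retract₁∘ι₂ : ∀ b → retract₁ (ι₂ b) ≡ snk
    retract₁∘ι₂ src       rewrite FinP.splitAt-↑ʳ k₁ (suc k₂) zero = refl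
    retract₁∘ι₂ snk       = refl
    retract₁∘ι₂ (inner j) rewrite FinP.splitAt-↑ʳ k₁ (suc k₂) (suc j) = refl

    retract₂∘ι₂ : ∀ b → retract₂ (ι₂ b) ≡ b
    retract₂∘ι₂ src       rewrite FinP.splitAt-↑ʳ k₁ (suc k₂) zero = refl
    retract₂∘ι₂ snk       = refl
    retract₂∘ι₂ (inner j) rewrite FinP.splitAt-↑ʳ k₁ (suc k₂) (suc j) = refl

    retract₂∘ι₁ : ∀ a → retract₂ (ι₁ a) ≡ src
    retract₂∘ι₁ src       = refl
    retract₂∘ι₁ snk       rewrite FinP.splitAt-↑ʳ k₁ (suc k₂) zero = refl
    retract₂∘ι₁ (inner i) rewrite FinP.splitAt-↑ˡ k₁ i (suc k₂) = refl

    module _ (A₁ : Subset (m G₁)) (A₂ : Subset (m G₂)) where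
      open Gluing G₁ G₂ (k₁ + suc k₂) (ends (G₁ ⋈ G₂)) ι₁ ι₂ ends-inl ends-inr cover A₁ A₂

      private
        onto₁ : ∀ {x y} → T (hasPath H A x y) → T (hasPath G₁ A₁ (retract₁ x) (retract₁ y))
        onto₁ = reachable⇒hasPath G₁ A₁
              ∘ contract-inl retract₁ retract₁∘ι₁ (λ b b′ → trans (retract₁∘ι₂ b) (sym (retract₁∘ι₂ b′)))
              ∘ hasPath⇒reachable H A

        onto₂ : ∀ {x y} → T (hasPath H A x y) → T (hasPath G₂ A₂ (retract₂ x) (retract₂ y))
        onto₂ = reachable⇒hasPath G₂ A₂
              ∘ contract-inr retract₂ retract₂∘ι₂ (λ a a′ → trans (retract₂∘ι₁ a) (sym (retract₂∘ι₁ a′)))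
              ∘ hasPath⇒reachable H A

      hasPath-inl-inl : ∀ a a′ → hasPath H A (ι₁ a) (ι₁ a′) ≡ hasPath G₁ A₁ a a′
      hasPath-inl-inl a a′ =
        T-ext (subst₂ (λ u v → T (hasPath G₁ A₁ u v)) (retract₁∘ι₁ a) (retract₁∘ι₁ a′) ∘ onto₁) hasPath-inl

      hasPath-inr-inr : ∀ b b′ → hasPath H A (ι₂ b) (ι₂ b′) ≡ hasPath G₂ A₂ b b′
      hasPath-inr-inr b b′ =
        T-ext (subst₂ (λ u v → T (hasPath G₂ A₂ u v)) (retract₂∘ι₂ b) (retract₂∘ι₂ b′) ∘ onto₂) hasPath-inr

      hasPath-inl-inr : ∀ a b → hasPath H A (ι₁ a) (ι₂ b) ≡ hasPath G₁ A₁ a snk ∧ hasPath G₂ A₂ src b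
      hasPath-inl-inr a b = T-ext path⇒ ⇒path
        where
        path⇒ : T (hasPath H A (ι₁ a) (ι₂ b)) → T (hasPath G₁ A₁ a snk ∧ hasPath G₂ A₂ src b)
        path⇒ p = from T-∧ ( subst₂ (λ u v → T (hasPath G₁ A₁ u v)) (retract₁∘ι₁ a) (retract₁∘ι₂ b) (onto₁ p)
                           , subst₂ (λ u v → T (hasPath G₂ A₂ u v)) (retract₂∘ι₁ a) (retract₂∘ι₂ b) (onto₂ p))
        ⇒path : T (hasPath G₁ A₁ a snk ∧ hasPath G₂ A₂ src b) → T (hasPath H A (ι₁ a) (ι₂ b))
        ⇒path t = let p₁ , p₂ = to (T-∧ {hasPath G₁ A₁ a snk}) t in
          reachable⇒hasPath H A (reachable-inl (hasPath⇒reachable G₁ A₁ p₁) ◅◅ reachable-inr (hasPath⇒reachable G₂ A₂ p₂))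

      linked-series : linked H A ≡ linked G₁ A₁ ∧ linked G₂ A₂
      linked-series = hasPath-inl-inr src snk

      anchored-series : anchored H A ≡ (anchored G₁ A₁ ∧ (linked G₁ A₁ ∨ linked G₂ A₂))
                                     ∧ (anchored G₂ A₂ ∧ (linked G₂ A₂ ∨ linked G₁ A₁))
      anchored-series = begin
        anchored H A
          ≡⟨ all-glued (reachesTerminal H A) ⟩
        all (reachesTerminal H A ∘ ι₁) (vertices k₁) ∧ all (reachesTerminal H A ∘ ι₂) (vertices k₂)
          ≡⟨ cong₂ _∧_ (all-cong part₁ (vertices k₁)) (all-cong part₂ (vertices k₂)) ⟩
        all (λ a → h₁ a src ∨ (h₁ a snk ∧ linked G₂ A₂)) (vertices k₁) ∧
        all (λ b → (h₂ b src ∧ linked G₁ A₁) ∨ h₂ b snk) (vertices k₂)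
          ≡⟨ cong₂ _∧_ (anchored-unless-snk G₁ A₁ (linked G₂ A₂)) (anchored-unless-src G₂ A₂ (linked G₁ A₁)) ⟩
        (anchored G₁ A₁ ∧ (linked G₁ A₁ ∨ linked G₂ A₂)) ∧ (anchored G₂ A₂ ∧ (linked G₂ A₂ ∨ linked G₁ A₁)) ∎
        where
        open ≡-Reasoning
        h₁ : Vtx k₁ → Vtx k₁ → Bool
        h₁ = hasPath G₁ A₁
        h₂ : Vtx k₂ → Vtx k₂ → Bool
        h₂ = hasPath G₂ A₂
        part₁ : ∀ a → reachesTerminal H A (ι₁ a) ≡ h₁ a src ∨ (h₁ a snk ∧ linked G₂ A₂)
        part₁ a = cong₂ _∨_ (hasPath-inl-inl a src) (hasPath-inl-inr a snk)
        part₂ : ∀ b → reachesTerminal H A (ι₂ b) ≡ (h₂ b src ∧ linked G₁ A₁) ∨ h₂ b snk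
        part₂ b = cong₂ _∨_ (begin
          hasPath H A (ι₂ b) (ι₁ src)   ≡⟨ hasPath-sym H A (ι₂ b) (ι₁ src) ⟩
          hasPath H A (ι₁ src) (ι₂ b)   ≡⟨ hasPath-inl-inr src b ⟩
          linked G₁ A₁ ∧ h₂ src b       ≡⟨ Bool.∧-comm (linked G₁ A₁) (h₂ src b) ⟩
          h₂ src b ∧ linked G₁ A₁       ≡⟨ cong (_∧ linked G₁ A₁) (hasPath-sym G₂ A₂ src b) ⟩
          h₂ b src ∧ linked G₁ A₁       ∎) (hasPath-inr-inr b snk)

      connected-series : connected H A ≡ connected G₁ A₁ ∧ connected G₂ A₂
      connected-series = begin
        connected H A                 ≡⟨ connected≡anchored∧linked H A ⟩
        anchored H A ∧ linked H A     ≡⟨ cong₂ _∧_ anchored-series linked-series ⟩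
        _                             ≡⟨ series-connected-law (anchored G₁ A₁) (linked G₁ A₁) (anchored G₂ A₂) (linked G₂ A₂) ⟩
        (anchored G₁ A₁ ∧ linked G₁ A₁) ∧ (anchored G₂ A₂ ∧ linked G₂ A₂)
          ≡⟨ sym (cong₂ _∧_ (connected≡anchored∧linked G₁ A₁) (connected≡anchored∧linked G₂ A₂)) ⟩
        connected G₁ A₁ ∧ connected G₂ A₂ ∎
        where open ≡-Reasoning

      stSplit-series : stSplit H A ≡ (connected G₁ A₁ ∧ stSplit G₂ A₂) ∨ (stSplit G₁ A₁ ∧ connected G₂ A₂)
      stSplit-series = begin
        stSplit H A                    ≡⟨ stSplit≡anchored∧¬linked H A ⟩
        anchored H A ∧ not (linked H A) ≡⟨ cong₂ (λ a b → a ∧ not b) anchored-series linked-series ⟩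
        _                              ≡⟨ series-split-law (anchored G₁ A₁) (linked G₁ A₁) (anchored G₂ A₂) (linked G₂ A₂) ⟩
        _
          ≡⟨ sym (cong₂ _∨_ (cong₂ _∧_ (connected≡anchored∧linked G₁ A₁) (stSplit≡anchored∧¬linked G₂ A₂))
                            (cong₂ _∧_ (stSplit≡anchored∧¬linked G₁ A₁) (connected≡anchored∧linked G₂ A₂))) ⟩
        (connected G₁ A₁ ∧ stSplit G₂ A₂) ∨ (stSplit G₁ A₁ ∧ connected G₂ A₂) ∎
        where open ≡-Reasoning

  -- Parallel composition

  parallel-connected-law : ∀ a₁ b₁ a₂ b₂ →
    (a₁ ∧ a₂) ∧ (b₁ ∨ b₂) ≡
    (((a₁ ∧ b₁) ∧ (a₂ ∧ b₂)) ∨ ((a₁ ∧ b₁) ∧ (a₂ ∧ not b₂))) ∨ ((a₁ ∧ not b₁) ∧ (a₂ ∧ b₂))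
  parallel-connected-law = by-truth-table

  parallel-split-law : ∀ a₁ b₁ a₂ b₂ → (a₁ ∧ a₂) ∧ not (b₁ ∨ b₂) ≡ (a₁ ∧ not b₁) ∧ (a₂ ∧ not b₂)
  parallel-split-law = by-truth-table

  module Parallel (G₁ G₂ : TwoTerminal) where
    private
      k₁ k₂ : ℕ
      k₁ = k G₁
      k₂ = k G₂

    ι₁ : Vtx k₁ → Vtx (k₁ + k₂)
    ι₁ src       = src
    ι₁ snk       = snk
    ι₁ (inner i) = inner (i ↑ˡ k₂)

    ι₂ : Vtx k₂ → Vtx (k₁ + k₂)
    ι₂ src       = src
    ι₂ snk       = snk
    ι₂ (inner j) = inner (k₁ ↑ʳ j)

    ends-inl : ∀ e → ends (G₁ ∥ G₂) (e ↑ˡ m G₂) ≡ Prod.map ι₁ ι₁ (ends G₁ e)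
    ends-inl e rewrite FinP.splitAt-↑ˡ (m G₁) e (m G₂) with ends G₁ e
    ... | src     , src     = refl
    ... | src     , snk     = refl
    ... | src     , inner _ = refl
    ... | snk     , src     = refl
    ... | snk     , snk     = refl
    ... | snk     , inner _ = refl
    ... | inner _ , src     = refl
    ... | inner _ , snk     = refl
    ... | inner _ , inner _ = refl

    ends-inr : ∀ e → ends (G₁ ∥ G₂) (m G₁ ↑ʳ e) ≡ Prod.map ι₂ ι₂ (ends G₂ e)
    ends-inr e rewrite FinP.splitAt-↑ʳ (m G₁) (m G₂) e with ends G₂ e
    ... | src     , src     = refl
    ... | src     , snk     = refl
    ... | src     , inner _ = refl
    ... | snk     , src     = refl
    ... | snk     , snk     = refl
    ... | snk     , inner _ = refl
    ... | inner _ , src     = refl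
    ... | inner _ , snk     = refl
    ... | inner _ , inner _ = refl

    cover : ∀ x → (∃ λ a → ι₁ a ≡ x) ⊎ (∃ λ b → ι₂ b ≡ x)
    cover src = inj₁ (src , refl)
    cover snk = inj₁ (snk , refl)
    cover (inner i) with splitAt k₁ i in eq
    ... | inj₁ i₁ = inj₁ (inner i₁ , cong inner (FinP.splitAt⁻¹-↑ˡ eq))
    ... | inj₂ i₂ = inj₂ (inner i₂ , cong inner (FinP.splitAt⁻¹-↑ʳ eq))

    module _ {B : Set} where

      glue : (Vtx k₁ → B) → (Vtx k₂ → B) → Vtx (k₁ + k₂) → B
      glue f₁ f₂ src       = f₁ src
      glue f₁ f₂ snk       = f₁ snk
      glue f₁ f₂ (inner i) = [ f₁ ∘ inner , f₂ ∘ inner ]′ (splitAt k₁ i)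

      AgreeOnTerminals : (Vtx k₁ → B) → (Vtx k₂ → B) → Set
      AgreeOnTerminals f₁ f₂ = f₁ src ≡ f₂ src × f₁ snk ≡ f₂ snk

      glue∘ι₁ : ∀ f₁ f₂ a → glue f₁ f₂ (ι₁ a) ≡ f₁ a
      glue∘ι₁ f₁ f₂ src       = refl
      glue∘ι₁ f₁ f₂ snk       = refl
      glue∘ι₁ f₁ f₂ (inner i) rewrite FinP.splitAt-↑ˡ k₁ i k₂ = refl

      glue∘ι₂ : ∀ {f₁ f₂} → AgreeOnTerminals f₁ f₂ → ∀ b → glue f₁ f₂ (ι₂ b) ≡ f₂ b
      glue∘ι₂ (same-src , _) src       = same-src
      glue∘ι₂ (_ , same-snk) snk       = same-snk
      glue∘ι₂ _              (inner j) rewrite FinP.splitAt-↑ʳ k₁ k₂ j = refl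

    module _ (A₁ : Subset (m G₁)) (A₂ : Subset (m G₂)) where
      open Gluing G₁ G₂ (k₁ + k₂) (ends (G₁ ∥ G₂)) ι₁ ι₂ ends-inl ends-inr cover A₁ A₂

      glue-along : ∀ {B : Set} {f₁ f₂} → AgreeOnTerminals {B} f₁ f₂ → Invariant G₁ A₁ f₁ → Invariant G₂ A₂ f₂ →
                   ∀ {x y} → T (hasPath H A x y) → glue f₁ f₂ x ≡ glue f₁ f₂ y
      glue-along {f₁ = f₁} {f₂} agree inv₁ inv₂ p = invariant-along H A glued-invariant (hasPath⇒reachable H A p)
        where
        glued-invariant : Invariant H A (glue f₁ f₂)
        glued-invariant = invariant-glued (glue f₁ f₂)
          (λ {x} {y} a → trans (glue∘ι₁ f₁ f₂ x) (trans (inv₁ a) (sym (glue∘ι₁ f₁ f₂ y))))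
          (λ {x} {y} a → trans (glue∘ι₂ agree x) (trans (inv₂ a) (sym (glue∘ι₂ agree y))))

      -- "Reaches a terminal within G₁", extended by true to the rest, is invariant along edges of G₁ ∥ G₂.
      reachesTerminal-inl : ∀ a → reachesTerminal H A (ι₁ a) ≡ reachesTerminal G₁ A₁ a
      reachesTerminal-inl a = T-ext to-G₁ from-G₁
        where
        label : Vtx (k₁ + k₂) → Bool
        label = glue (reachesTerminal G₁ A₁) (λ _ → true)
        agree : AgreeOnTerminals (reachesTerminal G₁ A₁) (λ _ → true)
        agree = reachesTerminal-src G₁ A₁ , reachesTerminal-snk G₁ A₁
        carry : ∀ t → T (hasPath H A (ι₁ a) (ι₁ t)) → reachesTerminal G₁ A₁ t ≡ true → T (reachesTerminal G₁ A₁ a)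
        carry t p t-reaches = subst T (sym (begin
          reachesTerminal G₁ A₁ a ≡⟨ sym (glue∘ι₁ _ _ a) ⟩
          label (ι₁ a)            ≡⟨ glue-along agree (reachesTerminal-invariant G₁ A₁) (λ _ → refl) p ⟩
          label (ι₁ t)            ≡⟨ glue∘ι₁ _ _ t ⟩
          reachesTerminal G₁ A₁ t ≡⟨ t-reaches ⟩
          true                    ∎)) tt
          where open ≡-Reasoning
        to-G₁ : T (reachesTerminal H A (ι₁ a)) → T (reachesTerminal G₁ A₁ a)
        to-G₁ t with to (T-∨ {hasPath H A (ι₁ a) src}) t
        ... | inj₁ p = carry src p (reachesTerminal-src G₁ A₁)
        ... | inj₂ p = carry snk p (reachesTerminal-snk G₁ A₁)
        from-G₁ : T (reachesTerminal G₁ A₁ a) → T (reachesTerminal H A (ι₁ a))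
        from-G₁ t with to (T-∨ {hasPath G₁ A₁ a src}) t
        ... | inj₁ p = from T-∨ (inj₁ (hasPath-inl p))
        ... | inj₂ p = from (T-∨ {hasPath H A (ι₁ a) src}) (inj₂ (hasPath-inl p))

      reachesTerminal-inr : ∀ b → reachesTerminal H A (ι₂ b) ≡ reachesTerminal G₂ A₂ b
      reachesTerminal-inr b = T-ext to-G₂ from-G₂
        where
        label : Vtx (k₁ + k₂) → Bool
        label = glue (λ _ → true) (reachesTerminal G₂ A₂)
        agree : AgreeOnTerminals (λ _ → true) (reachesTerminal G₂ A₂)
        agree = sym (reachesTerminal-src G₂ A₂) , sym (reachesTerminal-snk G₂ A₂)
        carry : ∀ t → T (hasPath H A (ι₂ b) (ι₂ t)) → reachesTerminal G₂ A₂ t ≡ true → T (reachesTerminal G₂ A₂ b)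
        carry t p t-reaches = subst T (sym (begin
          reachesTerminal G₂ A₂ b ≡⟨ sym (glue∘ι₂ agree b) ⟩
          label (ι₂ b)            ≡⟨ glue-along agree (λ _ → refl) (reachesTerminal-invariant G₂ A₂) p ⟩
          label (ι₂ t)            ≡⟨ glue∘ι₂ agree t ⟩
          reachesTerminal G₂ A₂ t ≡⟨ t-reaches ⟩
          true                    ∎)) tt
          where open ≡-Reasoning
        to-G₂ : T (reachesTerminal H A (ι₂ b)) → T (reachesTerminal G₂ A₂ b)
        to-G₂ t with to (T-∨ {hasPath H A (ι₂ b) src}) t
        ... | inj₁ p = carry src p (reachesTerminal-src G₂ A₂)
        ... | inj₂ p = carry snk p (reachesTerminal-snk G₂ A₂)
        from-G₂ : T (reachesTerminal G₂ A₂ b) → T (reachesTerminal H A (ι₂ b))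
        from-G₂ t with to (T-∨ {hasPath G₂ A₂ b src}) t
        ... | inj₁ p = from T-∨ (inj₁ (hasPath-inr p))
        ... | inj₂ p = from (T-∨ {hasPath H A (ι₂ b) src}) (inj₂ (hasPath-inr p))

      anchored-parallel : anchored H A ≡ anchored G₁ A₁ ∧ anchored G₂ A₂
      anchored-parallel = trans (all-glued (reachesTerminal H A))
        (cong₂ _∧_ (all-cong reachesTerminal-inl (vertices k₁)) (all-cong reachesTerminal-inr (vertices k₂)))

      -- If neither part links s to t, "reaches s within its own part" is a well-defined label on
      -- G₁ ∥ G₂ (false at t on both sides) that is invariant along edges, so s and t stay apart.
      linked-parallel : linked H A ≡ linked G₁ A₁ ∨ linked G₂ A₂
      linked-parallel = T-ext path⇒ ⇒path
        where
        ⇒path : T (linked G₁ A₁ ∨ linked G₂ A₂) → T (linked H A)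
        ⇒path t with to (T-∨ {linked G₁ A₁}) t
        ... | inj₁ p = hasPath-inl p
        ... | inj₂ p = hasPath-inr p
        path⇒ : T (linked H A) → T (linked G₁ A₁ ∨ linked G₂ A₂)
        path⇒ p = decidable-stable (T? _) not-unlinked
          where
          unlinked : ∀ G A → ¬ T (linked G A) → hasPath G A snk src ≡ false
          unlinked G A ¬l = to T-not-≡ (T-not⁺ (¬l ∘ subst T (hasPath-sym G A snk src)))
          not-unlinked : ¬ ¬ T (linked G₁ A₁ ∨ linked G₂ A₂)
          not-unlinked ¬linked = ¬linked (from T-∨ (inj₁ (subst T (sym linked₁) tt)))
            where
            open ≡-Reasoning
            agree : AgreeOnTerminals (λ a → hasPath G₁ A₁ a src) (λ b → hasPath G₂ A₂ b src)
            agree = trans (to T-≡ (reachable⇒hasPath G₁ A₁ ε)) (sym (to T-≡ (reachable⇒hasPath G₂ A₂ ε)))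
                  , trans (unlinked G₁ A₁ (¬linked ∘ from T-∨ ∘ inj₁))
                          (sym (unlinked G₂ A₂ (¬linked ∘ from (T-∨ {linked G₁ A₁}) ∘ inj₂)))
            linked₁ : linked G₁ A₁ ≡ true
            linked₁ = begin
              linked G₁ A₁            ≡⟨ hasPath-sym G₁ A₁ src snk ⟩
              hasPath G₁ A₁ snk src   ≡⟨ sym (glue-along agree (hasPath-invariant G₁ A₁ src) (hasPath-invariant G₂ A₂ src) p) ⟩
              hasPath G₁ A₁ src src   ≡⟨ to T-≡ (reachable⇒hasPath G₁ A₁ ε) ⟩
              true                    ∎

      connected-parallel : connected H A ≡
        ((connected G₁ A₁ ∧ connected G₂ A₂) ∨ (connected G₁ A₁ ∧ stSplit G₂ A₂)) ∨ (stSplit G₁ A₁ ∧ connected G₂ A₂)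
      connected-parallel = begin
        connected H A                ≡⟨ connected≡anchored∧linked H A ⟩
        anchored H A ∧ linked H A    ≡⟨ cong₂ _∧_ anchored-parallel linked-parallel ⟩
        _                            ≡⟨ parallel-connected-law (anchored G₁ A₁) (linked G₁ A₁) (anchored G₂ A₂) (linked G₂ A₂) ⟩
        _
          ≡⟨ sym (cong₂ _∨_ (cong₂ _∨_ (cong₂ _∧_ (connected≡anchored∧linked G₁ A₁) (connected≡anchored∧linked G₂ A₂))
                                       (cong₂ _∧_ (connected≡anchored∧linked G₁ A₁) (stSplit≡anchored∧¬linked G₂ A₂)))
                            (cong₂ _∧_ (stSplit≡anchored∧¬linked G₁ A₁) (connected≡anchored∧linked G₂ A₂))) ⟩
        ((connected G₁ A₁ ∧ connected G₂ A₂) ∨ (connected G₁ A₁ ∧ stSplit G₂ A₂)) ∨ (stSplit G₁ A₁ ∧ connected G₂ A₂) ∎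
        where open ≡-Reasoning

      stSplit-parallel : stSplit H A ≡ stSplit G₁ A₁ ∧ stSplit G₂ A₂
      stSplit-parallel = begin
        stSplit H A                     ≡⟨ stSplit≡anchored∧¬linked H A ⟩
        anchored H A ∧ not (linked H A) ≡⟨ cong₂ (λ a b → a ∧ not b) anchored-parallel linked-parallel ⟩
        _                               ≡⟨ parallel-split-law (anchored G₁ A₁) (linked G₁ A₁) (anchored G₂ A₂) (linked G₂ A₂) ⟩
        _                               ≡⟨ sym (cong₂ _∧_ (stSplit≡anchored∧¬linked G₁ A₁) (stSplit≡anchored∧¬linked G₂ A₂)) ⟩
        stSplit G₁ A₁ ∧ stSplit G₂ A₂   ∎
        where open ≡-Reasoning

  connected-stSplit-disjoint : ∀ G A → ¬ (T (connected G A) × T (stSplit G A))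
  connected-stSplit-disjoint G A (c , s) =
    T-not⁻ (proj₂ (to T-∧ (subst T (stSplit≡anchored∧¬linked G A) s)))
           (proj₂ (to (T-∧ {anchored G A}) (subst T (connected≡anchored∧linked G A) c)))

-- Polynomials

module Polynomials {c ℓ} (K : CommutativeRing c ℓ) where
  open Over K hiding (Poly)
  open CommutativeRing K hiding (zero)
  open import Algebra.Properties.Ring ring using (-0#≈0#; -‿distribʳ-*; -‿+-comm)
  open import Algebra.Solver.Ring.NaturalCoefficients.Default commutativeSemiring
  open import Relation.Binary.Reasoning.Setoid setoid

  -- _≈ₚ_ wrapped in a record, so that the two polynomials can be inferred from a proof.
  infix 4 _≋_
  record _≋_ (p q : Poly K) : Set ℓ where
    constructor coeffwise
    field coeff-≈ : p ≈ₚ q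
  open _≋_ public

  ≋-refl : ∀ {p} → p ≋ p
  ≋-refl = coeffwise λ _ → refl

  ≋-sym : ∀ {p q} → p ≋ q → q ≋ p
  ≋-sym (coeffwise e) = coeffwise λ i → sym (e i)

  ≋-trans : ∀ {p q r} → p ≋ q → q ≋ r → p ≋ r
  ≋-trans (coeffwise e) (coeffwise f) = coeffwise λ i → trans (e i) (f i)

  shift : Poly K → Poly K
  shift p = 0# ∷ p

  coeff-+ₚ : ∀ p q i → coeff (p +ₚ q) i ≈ coeff p i + coeff q i
  coeff-+ₚ []      q       i       = sym (+-identityˡ _)
  coeff-+ₚ (a ∷ p) []      i       = sym (+-identityʳ _)
  coeff-+ₚ (a ∷ p) (b ∷ q) zero    = refl
  coeff-+ₚ (a ∷ p) (b ∷ q) (suc i) = coeff-+ₚ p q i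

  coeff-scaleₚ : ∀ a p i → coeff (scaleₚ a p) i ≈ a * coeff p i
  coeff-scaleₚ a []      i       = sym (zeroʳ a)
  coeff-scaleₚ a (b ∷ p) zero    = refl
  coeff-scaleₚ a (b ∷ p) (suc i) = coeff-scaleₚ a p i

  coeff--ₚ : ∀ p i → coeff (-ₚ p) i ≈ - coeff p i
  coeff--ₚ []      i       = sym -0#≈0#
  coeff--ₚ (b ∷ p) zero    = refl
  coeff--ₚ (b ∷ p) (suc i) = coeff--ₚ p i

  +ₚ-cong : ∀ {p p′ q q′} → p ≋ p′ → q ≋ q′ → p +ₚ q ≋ p′ +ₚ q′
  +ₚ-cong {p} {p′} {q} {q′} (coeffwise e) (coeffwise f) =
    coeffwise λ i → trans (coeff-+ₚ p q i) (trans (+-cong (e i) (f i)) (sym (coeff-+ₚ p′ q′ i)))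

  +ₚ-comm : ∀ p q → p +ₚ q ≋ q +ₚ p
  +ₚ-comm p q = coeffwise λ i → trans (coeff-+ₚ p q i) (trans (+-comm _ _) (sym (coeff-+ₚ q p i)))

  +ₚ-assoc : ∀ p q r → (p +ₚ q) +ₚ r ≋ p +ₚ (q +ₚ r)
  +ₚ-assoc p q r = coeffwise λ i → begin
    coeff ((p +ₚ q) +ₚ r) i             ≈⟨ trans (coeff-+ₚ (p +ₚ q) r i) (+-congʳ (coeff-+ₚ p q i)) ⟩
    (coeff p i + coeff q i) + coeff r i ≈⟨ +-assoc _ _ _ ⟩
    coeff p i + (coeff q i + coeff r i) ≈⟨ sym (trans (coeff-+ₚ p (q +ₚ r) i) (+-congˡ (coeff-+ₚ q r i))) ⟩
    coeff (p +ₚ (q +ₚ r)) i             ∎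

  +ₚ-identityʳ : ∀ p → p +ₚ [] ≋ p
  +ₚ-identityʳ p = coeffwise λ i → trans (coeff-+ₚ p [] i) (+-identityʳ _)

  +ₚ-inverseʳ : ∀ p → p +ₚ (-ₚ p) ≋ []
  +ₚ-inverseʳ p = coeffwise λ i → trans (coeff-+ₚ p (-ₚ p) i) (trans (+-congˡ (coeff--ₚ p i)) (-‿inverseʳ _))

  -ₚ-cong : ∀ {p q} → p ≋ q → -ₚ p ≋ -ₚ q
  -ₚ-cong {p} {q} (coeffwise e) = coeffwise λ i → trans (coeff--ₚ p i) (trans (-‿cong (e i)) (sym (coeff--ₚ q i)))

  +ₚ-interchange : ∀ p q r s → (p +ₚ q) +ₚ (r +ₚ s) ≋ (p +ₚ r) +ₚ (q +ₚ s)
  +ₚ-interchange p q r s = coeffwise λ i → begin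
    coeff ((p +ₚ q) +ₚ (r +ₚ s)) i
      ≈⟨ trans (coeff-+ₚ (p +ₚ q) (r +ₚ s) i) (+-cong (coeff-+ₚ p q i) (coeff-+ₚ r s i)) ⟩
    (coeff p i + coeff q i) + (coeff r i + coeff s i)
      ≈⟨ solve 4 (λ a b c d → (a :+ b) :+ (c :+ d) := (a :+ c) :+ (b :+ d)) refl _ _ _ _ ⟩
    (coeff p i + coeff r i) + (coeff q i + coeff s i)
      ≈⟨ sym (trans (coeff-+ₚ (p +ₚ r) (q +ₚ s) i) (+-cong (coeff-+ₚ p r i) (coeff-+ₚ q s i))) ⟩
    coeff ((p +ₚ r) +ₚ (q +ₚ s)) i ∎

  +ₚ-swap : ∀ p q r → p +ₚ (q +ₚ r) ≋ q +ₚ (p +ₚ r)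
  +ₚ-swap p q r = ≋-trans (≋-sym (+ₚ-assoc p q r)) (≋-trans (+ₚ-cong (+ₚ-comm p q) ≋-refl) (+ₚ-assoc q p r))

  scaleₚ-cong : ∀ {a b p q} → a ≈ b → p ≋ q → scaleₚ a p ≋ scaleₚ b q
  scaleₚ-cong {a} {b} {p} {q} e (coeffwise f) =
    coeffwise λ i → trans (coeff-scaleₚ a p i) (trans (*-cong e (f i)) (sym (coeff-scaleₚ b q i)))

  scaleₚ-distribˡ : ∀ a p q → scaleₚ a (p +ₚ q) ≋ scaleₚ a p +ₚ scaleₚ a q
  scaleₚ-distribˡ a p q = coeffwise λ i → begin
    coeff (scaleₚ a (p +ₚ q)) i           ≈⟨ trans (coeff-scaleₚ a (p +ₚ q) i) (*-congˡ (coeff-+ₚ p q i)) ⟩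
    a * (coeff p i + coeff q i)           ≈⟨ distribˡ _ _ _ ⟩
    a * coeff p i + a * coeff q i
      ≈⟨ sym (trans (coeff-+ₚ (scaleₚ a p) (scaleₚ a q) i) (+-cong (coeff-scaleₚ a p i) (coeff-scaleₚ a q i))) ⟩
    coeff (scaleₚ a p +ₚ scaleₚ a q) i    ∎

  scaleₚ-distribʳ : ∀ a b p → scaleₚ (a + b) p ≋ scaleₚ a p +ₚ scaleₚ b p
  scaleₚ-distribʳ a b p = coeffwise λ i → begin
    coeff (scaleₚ (a + b) p) i            ≈⟨ trans (coeff-scaleₚ (a + b) p i) (distribʳ _ _ _) ⟩
    a * coeff p i + b * coeff p i
      ≈⟨ sym (trans (coeff-+ₚ (scaleₚ a p) (scaleₚ b p) i) (+-cong (coeff-scaleₚ a p i) (coeff-scaleₚ b p i))) ⟩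
    coeff (scaleₚ a p +ₚ scaleₚ b p) i    ∎

  scaleₚ-assoc : ∀ a b p → scaleₚ a (scaleₚ b p) ≋ scaleₚ (a * b) p
  scaleₚ-assoc a b p = coeffwise λ i → begin
    coeff (scaleₚ a (scaleₚ b p)) i   ≈⟨ trans (coeff-scaleₚ a (scaleₚ b p) i) (*-congˡ (coeff-scaleₚ b p i)) ⟩
    a * (b * coeff p i)               ≈⟨ sym (*-assoc _ _ _) ⟩
    (a * b) * coeff p i               ≈⟨ sym (coeff-scaleₚ (a * b) p i) ⟩
    coeff (scaleₚ (a * b) p) i        ∎

  scaleₚ-zero : ∀ {a} p → a ≈ 0# → scaleₚ a p ≋ []
  scaleₚ-zero {a} p e = coeffwise λ i → trans (coeff-scaleₚ a p i) (trans (*-congʳ e) (zeroˡ _))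

  scaleₚ-one : ∀ p → scaleₚ 1# p ≋ p
  scaleₚ-one p = coeffwise λ i → trans (coeff-scaleₚ 1# p i) (*-identityˡ _)

  ∷-cong : ∀ {a b p q} → a ≈ b → p ≋ q → a ∷ p ≋ b ∷ q
  ∷-cong e (coeffwise f) = coeffwise λ { zero → e ; (suc i) → f i }

  ∷-head : ∀ {a b p q} → a ∷ p ≋ b ∷ q → a ≈ b
  ∷-head (coeffwise f) = f zero

  ∷-tail : ∀ {a b p q} → a ∷ p ≋ b ∷ q → p ≋ q
  ∷-tail (coeffwise f) = coeffwise λ i → f (suc i)

  ∷-head-zero : ∀ {a p} → a ∷ p ≋ [] → a ≈ 0#
  ∷-head-zero (coeffwise f) = f zero

  ∷-tail-zero : ∀ {a p} → a ∷ p ≋ [] → p ≋ []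
  ∷-tail-zero (coeffwise f) = coeffwise λ i → f (suc i)

  shift-cong : ∀ {p q} → p ≋ q → shift p ≋ shift q
  shift-cong = ∷-cong refl

  shift-zero : shift [] ≋ []
  shift-zero = coeffwise λ { zero → refl ; (suc i) → refl }

  shift-+ₚ : ∀ p q → shift (p +ₚ q) ≋ shift p +ₚ shift q
  shift-+ₚ p q = ∷-cong (sym (+-identityʳ 0#)) ≋-refl

  scaleₚ-shift : ∀ a p → scaleₚ a (shift p) ≋ shift (scaleₚ a p)
  scaleₚ-shift a p = ∷-cong (zeroʳ a) ≋-refl

  *ₚ-congˡ : ∀ p {q q′} → q ≋ q′ → p *ₚ q ≋ p *ₚ q′
  *ₚ-congˡ []      e = ≋-refl
  *ₚ-congˡ (a ∷ p) e = +ₚ-cong (scaleₚ-cong refl e) (shift-cong (*ₚ-congˡ p e))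

  *ₚ-zeroʳ : ∀ p → p *ₚ [] ≋ []
  *ₚ-zeroʳ []      = ≋-refl
  *ₚ-zeroʳ (a ∷ p) = ≋-trans (shift-cong (*ₚ-zeroʳ p)) shift-zero

  *ₚ-zeroˡ : ∀ {p} → p ≋ [] → ∀ q → p *ₚ q ≋ []
  *ₚ-zeroˡ {[]}    e q = ≋-refl
  *ₚ-zeroˡ {a ∷ p} e q = +ₚ-cong (scaleₚ-zero q (∷-head-zero e))
                                 (≋-trans (shift-cong (*ₚ-zeroˡ (∷-tail-zero e) q)) shift-zero)

  *ₚ-congʳ : ∀ {p p′} → p ≋ p′ → ∀ q → p *ₚ q ≋ p′ *ₚ q
  *ₚ-congʳ {[]}    {[]}      e q = ≋-refl
  *ₚ-congʳ {[]}    {a′ ∷ p′} e q = ≋-sym (*ₚ-zeroˡ (≋-sym e) q)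
  *ₚ-congʳ {a ∷ p} {[]}      e q = *ₚ-zeroˡ e q
  *ₚ-congʳ {a ∷ p} {a′ ∷ p′} e q = +ₚ-cong (scaleₚ-cong (∷-head e) ≋-refl) (shift-cong (*ₚ-congʳ (∷-tail e) q))

  *ₚ-cong : ∀ {p p′ q q′} → p ≋ p′ → q ≋ q′ → p *ₚ q ≋ p′ *ₚ q′
  *ₚ-cong {p′ = p′} {q} e f = ≋-trans (*ₚ-congʳ e q) (*ₚ-congˡ p′ f)

  *ₚ-identityˡ : ∀ p → constₚ 1# *ₚ p ≋ p
  *ₚ-identityˡ p = ≋-trans (+ₚ-cong (scaleₚ-one p) shift-zero) (+ₚ-identityʳ p)

  *ₚ-distribˡ : ∀ p q r → p *ₚ (q +ₚ r) ≋ (p *ₚ q) +ₚ (p *ₚ r)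
  *ₚ-distribˡ []      q r = ≋-refl
  *ₚ-distribˡ (a ∷ p) q r =
    ≋-trans (+ₚ-cong (scaleₚ-distribˡ a q r) (≋-trans (shift-cong (*ₚ-distribˡ p q r)) (shift-+ₚ (p *ₚ q) (p *ₚ r))))
            (+ₚ-interchange (scaleₚ a q) (scaleₚ a r) (shift (p *ₚ q)) (shift (p *ₚ r)))

  *ₚ-distribʳ : ∀ p q r → (p +ₚ q) *ₚ r ≋ (p *ₚ r) +ₚ (q *ₚ r)
  *ₚ-distribʳ []      q       r = ≋-refl
  *ₚ-distribʳ (a ∷ p) []      r = ≋-sym (+ₚ-identityʳ _)
  *ₚ-distribʳ (a ∷ p) (b ∷ q) r =
    ≋-trans (+ₚ-cong (scaleₚ-distribʳ a b r) (≋-trans (shift-cong (*ₚ-distribʳ p q r)) (shift-+ₚ (p *ₚ r) (q *ₚ r))))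
            (+ₚ-interchange (scaleₚ a r) (scaleₚ b r) (shift (p *ₚ r)) (shift (q *ₚ r)))

  scaleₚ-*ₚ : ∀ a q r → scaleₚ a q *ₚ r ≋ scaleₚ a (q *ₚ r)
  scaleₚ-*ₚ a []      r = ≋-refl
  scaleₚ-*ₚ a (b ∷ q) r =
    ≋-trans (+ₚ-cong (≋-sym (scaleₚ-assoc a b r)) (≋-trans (shift-cong (scaleₚ-*ₚ a q r)) (≋-sym (scaleₚ-shift a (q *ₚ r)))))
            (≋-sym (scaleₚ-distribˡ a (scaleₚ b r) (shift (q *ₚ r))))

  shift-*ₚ : ∀ p r → shift p *ₚ r ≋ shift (p *ₚ r)
  shift-*ₚ p r = +ₚ-cong (scaleₚ-zero r refl) ≋-refl

  *ₚ-∷ : ∀ p b q → p *ₚ (b ∷ q) ≋ scaleₚ b p +ₚ shift (p *ₚ q)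
  *ₚ-∷ []      b q = ≋-sym shift-zero
  *ₚ-∷ (a ∷ p) b q = ≋-trans (+ₚ-cong (≋-refl {a * b ∷ scaleₚ a q}) (shift-cong (*ₚ-∷ p b q)))
                             (∷-cong (+-congʳ (*-comm a b)) (+ₚ-swap (scaleₚ a q) (scaleₚ b p) (shift (p *ₚ q))))

  *ₚ-comm : ∀ p q → p *ₚ q ≋ q *ₚ p
  *ₚ-comm []      q = ≋-sym (*ₚ-zeroʳ q)
  *ₚ-comm (a ∷ p) q = ≋-trans (+ₚ-cong (≋-refl {scaleₚ a q}) (shift-cong (*ₚ-comm p q))) (≋-sym (*ₚ-∷ q a p))

  *ₚ-assoc : ∀ p q r → (p *ₚ q) *ₚ r ≋ p *ₚ (q *ₚ r)
  *ₚ-assoc []      q r = ≋-refl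
  *ₚ-assoc (a ∷ p) q r = ≋-trans (*ₚ-distribʳ (scaleₚ a q) (shift (p *ₚ q)) r)
    (+ₚ-cong (scaleₚ-*ₚ a q r) (≋-trans (shift-*ₚ (p *ₚ q) r) (shift-cong (*ₚ-assoc p q r))))

  Poly-ring : CommutativeRing c ℓ
  Poly-ring = record
    { Carrier = Poly K ; _≈_ = _≋_ ; _+_ = _+ₚ_ ; _*_ = _*ₚ_ ; -_ = -ₚ_ ; 0# = [] ; 1# = constₚ 1#
    ; isCommutativeRing = record
      { isRing = record
        { +-isAbelianGroup = record
          { isGroup = record
            { isMonoid = record
              { isSemigroup = record
                { isMagma = record
                  { isEquivalence = record { refl = ≋-refl ; sym = ≋-sym ; trans = ≋-trans }
                  ; ∙-cong = +ₚ-cong }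
                ; assoc = +ₚ-assoc }
              ; identity = (λ _ → ≋-refl) , +ₚ-identityʳ }
            ; inverse = (λ p → ≋-trans (+ₚ-comm (-ₚ p) p) (+ₚ-inverseʳ p)) , +ₚ-inverseʳ
            ; ⁻¹-cong = -ₚ-cong }
          ; comm = +ₚ-comm }
        ; *-cong = *ₚ-cong
        ; *-assoc = *ₚ-assoc
        ; *-identity = *ₚ-identityˡ , (λ p → ≋-trans (*ₚ-comm p (constₚ 1#)) (*ₚ-identityˡ p))
        ; distrib = *ₚ-distribˡ , (λ r p q → *ₚ-distribʳ p q r) }
      ; *-comm = *ₚ-comm } }

  eval-+ₚ : ∀ p q x → eval (p +ₚ q) x ≈ eval p x + eval q x
  eval-+ₚ []      q       x = sym (+-identityˡ _)
  eval-+ₚ (a ∷ p) []      x = sym (+-identityʳ _)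
  eval-+ₚ (a ∷ p) (b ∷ q) x = begin
    (a + b) + x * eval (p +ₚ q) x        ≈⟨ +-congˡ (*-congˡ (eval-+ₚ p q x)) ⟩
    (a + b) + x * (eval p x + eval q x)  ≈⟨ solve 5 (λ a b x u v → (a :+ b) :+ x :* (u :+ v) := (a :+ x :* u) :+ (b :+ x :* v))
                                                  refl a b x (eval p x) (eval q x) ⟩
    (a + x * eval p x) + (b + x * eval q x) ∎

  eval-scaleₚ : ∀ a p x → eval (scaleₚ a p) x ≈ a * eval p x
  eval-scaleₚ a []      x = sym (zeroʳ a)
  eval-scaleₚ a (b ∷ p) x = begin
    a * b + x * eval (scaleₚ a p) x ≈⟨ +-congˡ (*-congˡ (eval-scaleₚ a p x)) ⟩
    a * b + x * (a * eval p x)      ≈⟨ solve 4 (λ a b x u → a :* b :+ x :* (a :* u) := a :* (b :+ x :* u)) refl a b x (eval p x) ⟩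
    a * (b + x * eval p x)          ∎

  eval--ₚ : ∀ p x → eval (-ₚ p) x ≈ - eval p x
  eval--ₚ []      x = sym -0#≈0#
  eval--ₚ (b ∷ p) x = begin
    - b + x * eval (-ₚ p) x   ≈⟨ +-congˡ (trans (*-congˡ (eval--ₚ p x)) (sym (-‿distribʳ-* x (eval p x)))) ⟩
    - b + - (x * eval p x)    ≈⟨ -‿+-comm b (x * eval p x) ⟩
    - (b + x * eval p x)      ∎

  eval-*ₚ : ∀ p q x → eval (p *ₚ q) x ≈ eval p x * eval q x
  eval-*ₚ []      q x = sym (zeroˡ _)
  eval-*ₚ (a ∷ p) q x = begin
    eval (scaleₚ a q +ₚ shift (p *ₚ q)) x            ≈⟨ eval-+ₚ (scaleₚ a q) (shift (p *ₚ q)) x ⟩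
    eval (scaleₚ a q) x + (0# + x * eval (p *ₚ q) x)
      ≈⟨ +-cong (eval-scaleₚ a q x) (trans (+-identityˡ _) (*-congˡ (eval-*ₚ p q x))) ⟩
    a * eval q x + x * (eval p x * eval q x)          ≈⟨ solve 4 (λ a x u v → a :* v :+ x :* (u :* v) := (a :+ x :* u) :* v)
                                                              refl a x (eval p x) (eval q x) ⟩
    (a + x * eval p x) * eval q x                      ∎

  DegreeAtMost : ℕ → Poly K → Set
  DegreeAtMost d p = length p ≤ suc d

  coeff-beyond : ∀ p {n} → length p ≤ n → coeff p n ≈ 0#
  coeff-beyond []      le        = refl
  coeff-beyond (a ∷ p) (s≤s le) = coeff-beyond p le

  length-+ₚ : ∀ p q {n} → length p ≤ n → length q ≤ n → length (p +ₚ q) ≤ n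
  length-+ₚ []      q       lp        lq        = lq
  length-+ₚ (a ∷ p) []      lp        lq        = lp
  length-+ₚ (a ∷ p) (b ∷ q) (s≤s lp) (s≤s lq) = s≤s (length-+ₚ p q lp lq)

  length--ₚ : ∀ p → length (-ₚ p) ≡ length p
  length--ₚ p = length-map -_ p

  length-*ₚ : ∀ p q d₁ d₂ → DegreeAtMost d₁ p → DegreeAtMost d₂ q → DegreeAtMost (d₁ +ℕ d₂) (p *ₚ q)
  length-*ₚ []          q d₁       d₂ lp        lq = z≤n
  length-*ₚ (a ∷ [])    q d₁       d₂ lp        lq =
    length-+ₚ (scaleₚ a q) (0# ∷ []) (≡.subst (_≤ _) (≡.sym (length-map (a *_) q)) (≤-trans lq (s≤s (m≤n+m d₂ d₁)))) (s≤s z≤n)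
  length-*ₚ (a ∷ b ∷ p) q (suc d₁) d₂ (s≤s lp) lq =
    length-+ₚ (scaleₚ a q) (shift ((b ∷ p) *ₚ q))
              (≡.subst (_≤ _) (≡.sym (length-map (a *_) q)) (≤-trans lq (s≤s (m≤n+m d₂ (suc d₁)))))
              (s≤s (length-*ₚ (b ∷ p) q d₁ d₂ lp lq))

  coeff-*ₚ-top : ∀ p q d₁ d₂ → DegreeAtMost d₁ p → DegreeAtMost d₂ q →
                 coeff (p *ₚ q) (d₁ +ℕ d₂) ≈ coeff p d₁ * coeff q d₂
  coeff-*ₚ-top []       q d₁       d₂ _        _  = sym (zeroˡ _)
  coeff-*ₚ-top (a ∷ []) q zero     d₂ _        _  =
    trans (coeff-+ₚ (scaleₚ a q) (0# ∷ []) d₂) (trans (+-cong (coeff-scaleₚ a q d₂) (coeff-≈ shift-zero d₂)) (+-identityʳ _))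
  coeff-*ₚ-top (a ∷ p)  q (suc d₁) d₂ (s≤s lp) lq = begin
    coeff (scaleₚ a q +ₚ shift (p *ₚ q)) (suc (d₁ +ℕ d₂))
      ≈⟨ coeff-+ₚ (scaleₚ a q) (shift (p *ₚ q)) _ ⟩
    coeff (scaleₚ a q) (suc (d₁ +ℕ d₂)) + coeff (p *ₚ q) (d₁ +ℕ d₂)
      ≈⟨ +-cong (trans (coeff-scaleₚ a q _) (trans (*-congˡ (coeff-beyond q (≤-trans lq (s≤s (m≤n+m d₂ d₁))))) (zeroʳ a)))
                (coeff-*ₚ-top p q d₁ d₂ lp lq) ⟩
    0# + coeff p d₁ * coeff q d₂
      ≈⟨ +-identityˡ _ ⟩
    coeff p d₁ * coeff q d₂ ∎

module FractionValues {c ℓ} (K : CommutativeRing c ℓ) (field-K : IsACF0 K) where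
  open Over K using (FracIs)
  open CommutativeRing K
  open IsACF0 field-K using (inverse)
  open import Algebra.Properties.Ring ring using (-1*x≈-x; -0#≈0#)
  open import Algebra.Solver.Ring.NaturalCoefficients.Default commutativeSemiring
  open import Relation.Binary.Reasoning.Setoid setoid

  *-nonzero : ∀ {a b} → ¬ (a ≈ 0#) → ¬ (b ≈ 0#) → ¬ (a * b ≈ 0#)
  *-nonzero {a} {b} a≉0 b≉0 ab≈0 with inverse a a≉0
  ... | a⁻¹ , aa⁻¹≈1 = b≉0 (begin
    b               ≈⟨ sym (*-identityˡ b) ⟩
    1# * b          ≈⟨ *-congʳ (sym aa⁻¹≈1) ⟩
    (a * a⁻¹) * b   ≈⟨ solve 3 (λ a a⁻¹ b → (a :* a⁻¹) :* b := a⁻¹ :* (a :* b)) refl a a⁻¹ b ⟩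
    a⁻¹ * (a * b)   ≈⟨ *-congˡ ab≈0 ⟩
    a⁻¹ * 0#        ≈⟨ zeroʳ a⁻¹ ⟩
    0#              ∎)

  FracIs-cong : ∀ {a a′ b b′} v → a ≈ a′ → b ≈ b′ → FracIs a b v → FracIs a′ b′ v
  FracIs-cong (fin v) a≈a′ b≈b′ (b≉0 , a≈vb) = b≉0 ∘ trans b≈b′ , trans (sym a≈a′) (trans a≈vb (*-congˡ b≈b′))
  FracIs-cong ∞       a≈a′ b≈b′ (a≉0 , b≈0)  = a≉0 ∘ trans a≈a′ , trans (sym b≈b′) b≈0

  FracIs-sum-minus-one : ∀ {p₁ q₁ p₂ q₂} v₁ v₂ → FracIs p₁ q₁ v₁ → FracIs p₂ q₂ v₂ → ¬ (v₁ ≡ ∞ × v₂ ≡ ∞) →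
                         FracIs ((p₁ * q₂ + q₁ * p₂) + - (q₁ * q₂)) (q₁ * q₂) ((v₁ +̂ v₂) -̂ 1̂ K)
  FracIs-sum-minus-one {p₁} {q₁} {p₂} {q₂} (fin a) (fin b) (q₁≉0 , p₁≈aq₁) (q₂≉0 , p₂≈bq₂) _ =
    *-nonzero q₁≉0 q₂≉0 , (begin
      (p₁ * q₂ + q₁ * p₂) + - (q₁ * q₂)          ≈⟨ +-congʳ (+-cong (*-congʳ p₁≈aq₁) (*-congˡ p₂≈bq₂)) ⟩
      ((a * q₁) * q₂ + q₁ * (b * q₂)) + - (q₁ * q₂)
        ≈⟨ +-cong (solve 4 (λ a b x y → (a :* x) :* y :+ x :* (b :* y) := (a :+ b) :* (x :* y)) refl a b q₁ q₂)
                  (sym (-1*x≈-x (q₁ * q₂))) ⟩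
      (a + b) * (q₁ * q₂) + (- 1#) * (q₁ * q₂)    ≈⟨ sym (distribʳ (q₁ * q₂) (a + b) (- 1#)) ⟩
      ((a + b) + - 1#) * (q₁ * q₂)                ∎)
  FracIs-sum-minus-one {p₁} {q₁} {p₂} {q₂} ∞ (fin b) (p₁≉0 , q₁≈0) (q₂≉0 , _) _ =
    (λ P≈0 → *-nonzero p₁≉0 q₂≉0 (trans (sym P≈p₁q₂) P≈0)) , trans (*-congʳ q₁≈0) (zeroˡ q₂)
    where
    P≈p₁q₂ : (p₁ * q₂ + q₁ * p₂) + - (q₁ * q₂) ≈ p₁ * q₂
    P≈p₁q₂ = begin
      (p₁ * q₂ + q₁ * p₂) + - (q₁ * q₂)   ≈⟨ +-cong (+-congˡ (trans (*-congʳ q₁≈0) (zeroˡ p₂)))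
                                                    (trans (-‿cong (trans (*-congʳ q₁≈0) (zeroˡ q₂))) -0#≈0#) ⟩
      (p₁ * q₂ + 0#) + 0#                 ≈⟨ trans (+-identityʳ _) (+-identityʳ _) ⟩
      p₁ * q₂                             ∎
  FracIs-sum-minus-one {p₁} {q₁} {p₂} {q₂} (fin a) ∞ (q₁≉0 , _) (p₂≉0 , q₂≈0) _ =
    (λ P≈0 → *-nonzero q₁≉0 p₂≉0 (trans (sym P≈q₁p₂) P≈0)) , trans (*-congˡ q₂≈0) (zeroʳ q₁)
    where
    P≈q₁p₂ : (p₁ * q₂ + q₁ * p₂) + - (q₁ * q₂) ≈ q₁ * p₂
    P≈q₁p₂ = begin
      (p₁ * q₂ + q₁ * p₂) + - (q₁ * q₂)   ≈⟨ +-cong (+-congʳ (trans (*-congˡ q₂≈0) (zeroʳ p₁)))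
                                                    (trans (-‿cong (trans (*-congˡ q₂≈0) (zeroʳ q₁))) -0#≈0#) ⟩
      (0# + q₁ * p₂) + 0#                 ≈⟨ trans (+-identityʳ _) (+-identityˡ _) ⟩
      q₁ * p₂                             ∎
  FracIs-sum-minus-one ∞ ∞ _ _ not-both = ⊥-elim (not-both (≡.refl , ≡.refl))

  FracIs-product : ∀ {p₁ q₁ p₂ q₂} w₁ w₂ → FracIs p₁ q₁ w₁ → FracIs p₂ q₂ w₂ →
                   ¬ (IsZeroĈ K w₁ × w₂ ≡ ∞) → ¬ (w₁ ≡ ∞ × IsZeroĈ K w₂) →
                   FracIs (p₁ * p₂) (q₁ * q₂) (w₁ *̂ w₂)
  FracIs-product {p₁} {q₁} {p₂} {q₂} (fin a) (fin b) (q₁≉0 , p₁≈aq₁) (q₂≉0 , p₂≈bq₂) _ _ =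
    *-nonzero q₁≉0 q₂≉0 , (begin
      p₁ * p₂               ≈⟨ *-cong p₁≈aq₁ p₂≈bq₂ ⟩
      (a * q₁) * (b * q₂)   ≈⟨ solve 4 (λ a b x y → (a :* x) :* (b :* y) := (a :* b) :* (x :* y)) refl a b q₁ q₂ ⟩
      (a * b) * (q₁ * q₂)   ∎)
  FracIs-product ∞ (fin b) (p₁≉0 , q₁≈0) (q₂≉0 , p₂≈bq₂) _ not-∞-0 =
    *-nonzero p₁≉0 (λ p₂≈0 → *-nonzero (λ b≈0 → not-∞-0 (≡.refl , b≈0)) q₂≉0 (trans (sym p₂≈bq₂) p₂≈0)) ,
    trans (*-congʳ q₁≈0) (zeroˡ _)
  FracIs-product (fin a) ∞ (q₁≉0 , p₁≈aq₁) (p₂≉0 , q₂≈0) not-0-∞ _ =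
    *-nonzero (λ p₁≈0 → *-nonzero (λ a≈0 → not-0-∞ (a≈0 , ≡.refl)) q₁≉0 (trans (sym p₁≈aq₁) p₁≈0)) p₂≉0 ,
    trans (*-congˡ q₂≈0) (zeroʳ _)
  FracIs-product ∞ ∞ (p₁≉0 , q₁≈0) (p₂≉0 , _) _ _ =
    *-nonzero p₁≉0 p₂≉0 , trans (*-congʳ q₁≈0) (zeroˡ _)

module SubsetSums {c ℓ} (K : CommutativeRing c ℓ) where
  open import Data.Nat using (_+_)
  open import Data.Vec using ([]; _∷_)
  open Over K using (_+ₚ_; _*ₚ_; -ₚ_; _^ₚ_; constₚ; Xₚ; sumₚ; weight)
  open CommutativeRing K using () renaming (1# to 1K)
  open Polynomials K
  open import Algebra.Solver.Ring.NaturalCoefficients.Default (CommutativeRing.commutativeSemiring Poly-ring)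
  open import Relation.Binary.Reasoning.Setoid (CommutativeRing.setoid Poly-ring)

  Σ : ∀ {a} {X : Set a} → (X → Poly K) → List X → Poly K
  Σ f xs = sumₚ (map f xs)

  Σ-cong : ∀ {a} {X : Set a} {f g : X → Poly K} xs → (∀ x → f x ≋ g x) → Σ f xs ≋ Σ g xs
  Σ-cong []       f≋g = ≋-refl
  Σ-cong (x ∷ xs) f≋g = +ₚ-cong (f≋g x) (Σ-cong xs f≋g)

  Σ-++ : ∀ {a} {X : Set a} (f : X → Poly K) xs ys → Σ f (xs ++ˡ ys) ≋ Σ f xs +ₚ Σ f ys
  Σ-++ f []       ys = ≋-refl
  Σ-++ f (x ∷ xs) ys = ≋-trans (+ₚ-cong (≋-refl {f x}) (Σ-++ f xs ys)) (≋-sym (+ₚ-assoc (f x) (Σ f xs) (Σ f ys)))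

  Σ-map : ∀ {a b} {X : Set a} {Y : Set b} (f : Y → Poly K) (h : X → Y) xs → Σ f (map h xs) ≡ Σ (λ x → f (h x)) xs
  Σ-map f h []       = ≡.refl
  Σ-map f h (x ∷ xs) = ≡.cong (f (h x) +ₚ_) (Σ-map f h xs)

  Σ-+ₚ : ∀ {a} {X : Set a} (f g : X → Poly K) xs → Σ (λ x → f x +ₚ g x) xs ≋ Σ f xs +ₚ Σ g xs
  Σ-+ₚ f g []       = ≋-refl
  Σ-+ₚ f g (x ∷ xs) = ≋-trans (+ₚ-cong (≋-refl {f x +ₚ g x}) (Σ-+ₚ f g xs)) (+ₚ-interchange (f x) (g x) (Σ f xs) (Σ g xs))

  Σ-*ₚˡ : ∀ {a} {X : Set a} p (f : X → Poly K) xs → Σ (λ x → p *ₚ f x) xs ≋ p *ₚ Σ f xs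
  Σ-*ₚˡ p f []       = ≋-sym (*ₚ-zeroʳ p)
  Σ-*ₚˡ p f (x ∷ xs) = ≋-trans (+ₚ-cong (≋-refl {p *ₚ f x}) (Σ-*ₚˡ p f xs)) (≋-sym (*ₚ-distribˡ p (f x) (Σ f xs)))

  Σ-*ₚʳ : ∀ {a} {X : Set a} p (f : X → Poly K) xs → Σ (λ x → f x *ₚ p) xs ≋ Σ f xs *ₚ p
  Σ-*ₚʳ p f xs = ≋-trans (Σ-cong xs (λ x → *ₚ-comm (f x) p)) (≋-trans (Σ-*ₚˡ p f xs) (*ₚ-comm p (Σ f xs)))

  Σ-allSubsets-++ : ∀ m₁ m₂ (g : Subset (m₁ + m₂) → Poly K) →
    Σ g (allSubsets (m₁ + m₂)) ≋ Σ (λ A₁ → Σ (λ A₂ → g (A₁ ++ A₂)) (allSubsets m₂)) (allSubsets m₁)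
  Σ-allSubsets-++ zero     m₂ g = ≋-sym (+ₚ-identityʳ _)
  Σ-allSubsets-++ (suc m₁) m₂ g = begin
    Σ g (map (false ∷_) S₁₂ ++ˡ map (true ∷_) S₁₂)
      ≈⟨ Σ-++ g (map (false ∷_) S₁₂) (map (true ∷_) S₁₂) ⟩
    Σ g (map (false ∷_) S₁₂) +ₚ Σ g (map (true ∷_) S₁₂)
      ≡⟨ ≡.cong₂ _+ₚ_ (Σ-map g (false ∷_) S₁₂) (Σ-map g (true ∷_) S₁₂) ⟩
    Σ (λ A → g (false ∷ A)) S₁₂ +ₚ Σ (λ A → g (true ∷ A)) S₁₂
      ≈⟨ +ₚ-cong (Σ-allSubsets-++ m₁ m₂ (λ A → g (false ∷ A))) (Σ-allSubsets-++ m₁ m₂ (λ A → g (true ∷ A))) ⟩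
    Σ (λ A → F (false ∷ A)) S₁ +ₚ Σ (λ A → F (true ∷ A)) S₁
      ≡⟨ ≡.sym (≡.cong₂ _+ₚ_ (Σ-map F (false ∷_) S₁) (Σ-map F (true ∷_) S₁)) ⟩
    Σ F (map (false ∷_) S₁) +ₚ Σ F (map (true ∷_) S₁)
      ≈⟨ ≋-sym (Σ-++ F (map (false ∷_) S₁) (map (true ∷_) S₁)) ⟩
    Σ F (allSubsets (suc m₁)) ∎
    where
    S₁₂ : List (Subset (m₁ + m₂))
    S₁₂ = allSubsets (m₁ + m₂)
    S₁ : List (Subset m₁)
    S₁ = allSubsets m₁
    F : Subset (suc m₁) → Poly K
    F A₁ = Σ (λ A₂ → g (A₁ ++ A₂)) (allSubsets m₂)

  1-p : Poly K
  1-p = constₚ 1K +ₚ (-ₚ Xₚ)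

  weight-∷ : ∀ m b (A : Subset m) → weight (suc m) (b ∷ A) ≋ (if b then 1-p else Xₚ) *ₚ weight m A
  weight-∷ m true  A = *ₚ-assoc 1-p (1-p ^ₚ ∣ A ∣) (Xₚ ^ₚ (m ∸ ∣ A ∣))
  weight-∷ m false A = begin
    (1-p ^ₚ ∣ A ∣) *ₚ (Xₚ ^ₚ (suc m ∸ ∣ A ∣))           ≡⟨ ≡.cong (λ n → (1-p ^ₚ ∣ A ∣) *ₚ (Xₚ ^ₚ n)) (+-∸-assoc 1 (∣p∣≤n A)) ⟩
    (1-p ^ₚ ∣ A ∣) *ₚ (Xₚ *ₚ (Xₚ ^ₚ (m ∸ ∣ A ∣)))
      ≈⟨ solve 3 (λ u x y → u :* (x :* y) := x :* (u :* y)) ≋-refl (1-p ^ₚ ∣ A ∣) Xₚ (Xₚ ^ₚ (m ∸ ∣ A ∣)) ⟩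
    Xₚ *ₚ ((1-p ^ₚ ∣ A ∣) *ₚ (Xₚ ^ₚ (m ∸ ∣ A ∣)))       ∎

  weight-++ : ∀ m₁ m₂ (A₁ : Subset m₁) (A₂ : Subset m₂) → weight (m₁ + m₂) (A₁ ++ A₂) ≋ weight m₁ A₁ *ₚ weight m₂ A₂
  weight-++ zero     m₂ []       A₂ = ≋-sym (≋-trans (*ₚ-congʳ (*ₚ-identityˡ (constₚ 1K)) _) (*ₚ-identityˡ _))
  weight-++ (suc m₁) m₂ (b ∷ A₁) A₂ = begin
    weight (suc (m₁ + m₂)) (b ∷ (A₁ ++ A₂))        ≈⟨ weight-∷ (m₁ + m₂) b (A₁ ++ A₂) ⟩
    f *ₚ weight (m₁ + m₂) (A₁ ++ A₂)               ≈⟨ *ₚ-congˡ f (weight-++ m₁ m₂ A₁ A₂) ⟩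
    f *ₚ (weight m₁ A₁ *ₚ weight m₂ A₂)            ≈⟨ ≋-sym (*ₚ-assoc f (weight m₁ A₁) (weight m₂ A₂)) ⟩
    (f *ₚ weight m₁ A₁) *ₚ weight m₂ A₂            ≈⟨ *ₚ-congʳ (≋-sym (weight-∷ m₁ b A₁)) (weight m₂ A₂) ⟩
    weight (suc m₁) (b ∷ A₁) *ₚ weight m₂ A₂       ∎
    where
    f : Poly K
    f = if b then 1-p else Xₚ

  [_]·_ : Bool → Poly K → Poly K
  [ b ]· p = if b then p else []

  [-]·-cong : ∀ b {p q} → p ≋ q → [ b ]· p ≋ [ b ]· q
  [-]·-cong true  p≋q = p≋q
  [-]·-cong false _   = ≋-refl

  [∧]· : ∀ a b p q → [ a ∧ b ]· (p *ₚ q) ≋ ([ a ]· p) *ₚ ([ b ]· q)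
  [∧]· true  true  p q = ≋-refl
  [∧]· true  false p q = ≋-sym (*ₚ-zeroʳ p)
  [∧]· false b     p q = ≋-refl

  [∨]· : ∀ a b p → ¬ (T a × T b) → [ a ∨ b ]· p ≋ ([ a ]· p) +ₚ ([ b ]· p)
  [∨]· true  true  p both = ⊥-elim (both (tt , tt))
  [∨]· true  false p _    = ≋-sym (+ₚ-identityʳ p)
  [∨]· false b     p _    = ≋-refl

  sumₚ-filter : ∀ {a} {X : Set a} (w : X → Poly K) (P : X → Bool) xs →
                sumₚ (map w (filterᵇ P xs)) ≡ Σ (λ x → [ P x ]· w x) xs
  sumₚ-filter w P []       = ≡.refl
  sumₚ-filter w P (x ∷ xs) with P x
  ... | true  = ≡.cong (w x +ₚ_) (sumₚ-filter w P xs)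
  ... | false = sumₚ-filter w P xs

  generating : ∀ {m} → (Subset m → Bool) → Poly K
  generating {m} P = sumₚ (map (weight m) (filterᵇ P (allSubsets m)))

  module _ {m₁ m₂ : ℕ} where

    generating₂ : (Subset m₁ → Subset m₂ → Bool) → Poly K
    generating₂ F = Σ (λ A₁ → Σ (λ A₂ → [ F A₁ A₂ ]· (weight m₁ A₁ *ₚ weight m₂ A₂)) (allSubsets m₂)) (allSubsets m₁)

    generating-++ : ∀ (P : Subset (m₁ + m₂) → Bool) F → (∀ A₁ A₂ → P (A₁ ++ A₂) ≡ F A₁ A₂) → generating P ≋ generating₂ F
    generating-++ P F P≡F = begin
      generating P
        ≡⟨ sumₚ-filter (weight (m₁ + m₂)) P (allSubsets (m₁ + m₂)) ⟩
      Σ (λ A → [ P A ]· weight (m₁ + m₂) A) (allSubsets (m₁ + m₂))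
        ≈⟨ Σ-allSubsets-++ m₁ m₂ _ ⟩
      Σ (λ A₁ → Σ (λ A₂ → [ P (A₁ ++ A₂) ]· weight (m₁ + m₂) (A₁ ++ A₂)) (allSubsets m₂)) (allSubsets m₁)
        ≈⟨ Σ-cong (allSubsets m₁) (λ A₁ → Σ-cong (allSubsets m₂) (λ A₂ →
             ≡.subst (λ b → [ P (A₁ ++ A₂) ]· weight (m₁ + m₂) (A₁ ++ A₂) ≋ [ b ]· (weight m₁ A₁ *ₚ weight m₂ A₂))
                     (P≡F A₁ A₂) ([-]·-cong (P (A₁ ++ A₂)) (weight-++ m₁ m₂ A₁ A₂)))) ⟩
      generating₂ F ∎

    generating₂-∧ : ∀ P₁ P₂ → generating₂ (λ A₁ A₂ → P₁ A₁ ∧ P₂ A₂) ≋ generating P₁ *ₚ generating P₂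
    generating₂-∧ P₁ P₂ = begin
      generating₂ (λ A₁ A₂ → P₁ A₁ ∧ P₂ A₂)
        ≈⟨ Σ-cong (allSubsets m₁) (λ A₁ → Σ-cong (allSubsets m₂) (λ A₂ → [∧]· (P₁ A₁) (P₂ A₂) (weight m₁ A₁) (weight m₂ A₂))) ⟩
      Σ (λ A₁ → Σ (λ A₂ → ([ P₁ A₁ ]· weight m₁ A₁) *ₚ ([ P₂ A₂ ]· weight m₂ A₂)) (allSubsets m₂)) (allSubsets m₁)
        ≈⟨ Σ-cong (allSubsets m₁) (λ A₁ → Σ-*ₚˡ ([ P₁ A₁ ]· weight m₁ A₁) (λ A₂ → [ P₂ A₂ ]· weight m₂ A₂) (allSubsets m₂)) ⟩
      Σ (λ A₁ → ([ P₁ A₁ ]· weight m₁ A₁) *ₚ Σ (λ A₂ → [ P₂ A₂ ]· weight m₂ A₂) (allSubsets m₂)) (allSubsets m₁)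
        ≈⟨ Σ-*ₚʳ _ (λ A₁ → [ P₁ A₁ ]· weight m₁ A₁) (allSubsets m₁) ⟩
      Σ (λ A₁ → [ P₁ A₁ ]· weight m₁ A₁) (allSubsets m₁) *ₚ Σ (λ A₂ → [ P₂ A₂ ]· weight m₂ A₂) (allSubsets m₂)
        ≡⟨ ≡.sym (≡.cong₂ _*ₚ_ (sumₚ-filter (weight m₁) P₁ (allSubsets m₁)) (sumₚ-filter (weight m₂) P₂ (allSubsets m₂))) ⟩
      generating P₁ *ₚ generating P₂ ∎

    generating₂-∨ : ∀ F G → (∀ A₁ A₂ → ¬ (T (F A₁ A₂) × T (G A₁ A₂))) →
                    generating₂ (λ A₁ A₂ → F A₁ A₂ ∨ G A₁ A₂) ≋ generating₂ F +ₚ generating₂ G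
    generating₂-∨ F G disjoint = ≋-trans
      (Σ-cong (allSubsets m₁) (λ A₁ → ≋-trans
        (Σ-cong (allSubsets m₂) (λ A₂ → [∨]· (F A₁ A₂) (G A₁ A₂) (weight m₁ A₁ *ₚ weight m₂ A₂) (disjoint A₁ A₂)))
        (Σ-+ₚ (λ A₂ → [ F A₁ A₂ ]· _) (λ A₂ → [ G A₁ A₂ ]· _) (allSubsets m₂))))
      (Σ-+ₚ _ _ (allSubsets m₁))

-- Composition laws for R, S, y and ŷ

module Decomposition {c ℓ} (K : CommutativeRing c ℓ) (G₁ G₂ : TwoTerminal) where
  open Connectivity using (connected-stSplit-disjoint; module Series; module Parallel)
  open Over K using (_+ₚ_; _*ₚ_)
  open Polynomials K
  open SubsetSums K

  private
    c∧s-disjoint : ∀ {a b} A₁ → ¬ (T (connected G₁ A₁ ∧ a) × T (stSplit G₁ A₁ ∧ b))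
    c∧s-disjoint A₁ (t , u) = connected-stSplit-disjoint G₁ A₁ (proj₁ (to T-∧ t) , proj₁ (to T-∧ u))

  R-series : R K (G₁ ⋈ G₂) ≋ R K G₁ *ₚ R K G₂
  R-series = ≋-trans (generating-++ (connected (G₁ ⋈ G₂)) _ (Series.connected-series G₁ G₂))
                     (generating₂-∧ (connected G₁) (connected G₂))

  S-series : S K (G₁ ⋈ G₂) ≋ (R K G₁ *ₚ S K G₂) +ₚ (S K G₁ *ₚ R K G₂)
  S-series = ≋-trans (generating-++ (stSplit (G₁ ⋈ G₂)) _ (Series.stSplit-series G₁ G₂))
    (≋-trans (generating₂-∨ (λ A₁ A₂ → connected G₁ A₁ ∧ stSplit G₂ A₂) (λ A₁ A₂ → stSplit G₁ A₁ ∧ connected G₂ A₂)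
                            (λ A₁ A₂ → c∧s-disjoint A₁))
             (+ₚ-cong (generating₂-∧ (connected G₁) (stSplit G₂)) (generating₂-∧ (stSplit G₁) (connected G₂))))

  R-parallel : R K (G₁ ∥ G₂) ≋ ((R K G₁ *ₚ R K G₂) +ₚ (R K G₁ *ₚ S K G₂)) +ₚ (S K G₁ *ₚ R K G₂)
  R-parallel = ≋-trans (generating-++ (connected (G₁ ∥ G₂)) _ (Parallel.connected-parallel G₁ G₂))
    (≋-trans (generating₂-∨ _ (λ A₁ A₂ → stSplit G₁ A₁ ∧ connected G₂ A₂) outer-disjoint)
    (+ₚ-cong (≋-trans (generating₂-∨ (λ A₁ A₂ → connected G₁ A₁ ∧ connected G₂ A₂)
                                     (λ A₁ A₂ → connected G₁ A₁ ∧ stSplit G₂ A₂) inner-disjoint)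
                      (+ₚ-cong (generating₂-∧ (connected G₁) (connected G₂)) (generating₂-∧ (connected G₁) (stSplit G₂))))
             (generating₂-∧ (stSplit G₁) (connected G₂))))
    where
    outer-disjoint : ∀ A₁ A₂ → ¬ (T ((connected G₁ A₁ ∧ connected G₂ A₂) ∨ (connected G₁ A₁ ∧ stSplit G₂ A₂))
                                  × T (stSplit G₁ A₁ ∧ connected G₂ A₂))
    outer-disjoint A₁ A₂ (t , u) = [ (λ t′ → c∧s-disjoint A₁ (t′ , u)) , (λ t′ → c∧s-disjoint A₁ (t′ , u)) ]′
                                   (to (T-∨ {connected G₁ A₁ ∧ connected G₂ A₂}) t)
    inner-disjoint : ∀ A₁ A₂ → ¬ (T (connected G₁ A₁ ∧ connected G₂ A₂) × T (connected G₁ A₁ ∧ stSplit G₂ A₂))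
    inner-disjoint A₁ A₂ (t , u) =
      connected-stSplit-disjoint G₂ A₂ (proj₂ (to (T-∧ {connected G₁ A₁}) t) , proj₂ (to (T-∧ {connected G₁ A₁}) u))

  S-parallel : S K (G₁ ∥ G₂) ≋ S K G₁ *ₚ S K G₂
  S-parallel = ≋-trans (generating-++ (stSplit (G₁ ∥ G₂)) _ (Parallel.stSplit-parallel G₁ G₂))
                       (generating₂-∧ (stSplit G₁) (stSplit G₂))

subtract-cancel : ∀ {c ℓ} (R : CommutativeRing c ℓ) → let open CommutativeRing R in
                  ∀ x z r {y} → x * r ≈ y + z * r → (x + - z) * r ≈ y
subtract-cancel R x z r {y} xr≈y+zr = begin
  (x + - z) * r            ≈⟨ distribʳ r x (- z) ⟩
  x * r + - z * r          ≈⟨ +-cong xr≈y+zr (sym (-‿distribˡ-* z r)) ⟩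
  (y + z * r) + - (z * r)  ≈⟨ //-rightDividesʳ (z * r) y ⟩
  y                        ∎
  where
  open CommutativeRing R
  open import Algebra.Properties.Ring ring using (-‿distribˡ-*)
  open import Algebra.Properties.Group +-group using (//-rightDividesʳ)
  open import Relation.Binary.Reasoning.Setoid setoid

module Composition {c ℓ} (K : CommutativeRing c ℓ) (field-K : IsACF0 K) (G₁ G₂ : TwoTerminal) where
  open Over K using (_+ₚ_; _*ₚ_; -ₚ_; constₚ; coeff; eval)
  open CommutativeRing K using (1#)
  open Polynomials K
  open SubsetSums K using (1-p)
  open Decomposition K G₁ G₂
  open FractionValues K field-K
  open import Algebra.Solver.Ring.NaturalCoefficients.Default (CommutativeRing.commutativeSemiring Poly-ring)
  open import Relation.Binary.Reasoning.Setoid (CommutativeRing.setoid Poly-ring)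
  open import Algebra.Properties.Ring (CommutativeRing.ring Poly-ring) using (-1*x≈-x)

  private
    R₁ R₂ S₁ S₂ : Poly K
    R₁ = R K G₁
    R₂ = R K G₂
    S₁ = S K G₁
    S₂ = S K G₂

  numerator : TwoTerminal → Poly K
  numerator G = (1-p *ₚ S K G) +ₚ R K G

  -- Written Q₁ P₂ rather than P₂ Q₁ so that every product has degree bound d₁ + d₂ at p₀ = ∞.
  sum-minus-one : Poly K → Poly K → Poly K → Poly K → Poly K
  sum-minus-one P₁ Q₁ P₂ Q₂ = ((P₁ *ₚ Q₂) +ₚ (Q₁ *ₚ P₂)) +ₚ (-ₚ (Q₁ *ₚ Q₂))

  series-representation : ∀ P₁ Q₁ P₂ Q₂ →
    P₁ *ₚ R₁ ≋ numerator G₁ *ₚ Q₁ → P₂ *ₚ R₂ ≋ numerator G₂ *ₚ Q₂ →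
    sum-minus-one P₁ Q₁ P₂ Q₂ *ₚ R K (G₁ ⋈ G₂) ≋ numerator (G₁ ⋈ G₂) *ₚ (Q₁ *ₚ Q₂)
  series-representation P₁ Q₁ P₂ Q₂ rep₁ rep₂ = begin
    sum-minus-one P₁ Q₁ P₂ Q₂ *ₚ R K (G₁ ⋈ G₂)       ≈⟨ *ₚ-congˡ (sum-minus-one P₁ Q₁ P₂ Q₂) R-series ⟩
    sum-minus-one P₁ Q₁ P₂ Q₂ *ₚ (R₁ *ₚ R₂)
      ≈⟨ subtract-cancel Poly-ring ((P₁ *ₚ Q₂) +ₚ (Q₁ *ₚ P₂)) (Q₁ *ₚ Q₂) (R₁ *ₚ R₂) cross-terms ⟩
    N *ₚ (Q₁ *ₚ Q₂)                                  ≈⟨ *ₚ-congʳ (≋-sym numerator-series) (Q₁ *ₚ Q₂) ⟩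
    numerator (G₁ ⋈ G₂) *ₚ (Q₁ *ₚ Q₂)                ∎
    where
    N : Poly K
    N = (1-p *ₚ ((R₁ *ₚ S₂) +ₚ (S₁ *ₚ R₂))) +ₚ (R₁ *ₚ R₂)
    numerator-series : numerator (G₁ ⋈ G₂) ≋ N
    numerator-series = +ₚ-cong (*ₚ-congˡ 1-p S-series) R-series
    cross-terms : ((P₁ *ₚ Q₂) +ₚ (Q₁ *ₚ P₂)) *ₚ (R₁ *ₚ R₂) ≋ (N *ₚ (Q₁ *ₚ Q₂)) +ₚ ((Q₁ *ₚ Q₂) *ₚ (R₁ *ₚ R₂))
    cross-terms = begin
      ((P₁ *ₚ Q₂) +ₚ (Q₁ *ₚ P₂)) *ₚ (R₁ *ₚ R₂)
        ≈⟨ solve 6 (λ p₁ q₁ p₂ q₂ r₁ r₂ → ((p₁ :* q₂) :+ (q₁ :* p₂)) :* (r₁ :* r₂)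
                                           := ((p₁ :* r₁) :* (q₂ :* r₂)) :+ ((q₁ :* r₁) :* (p₂ :* r₂)))
                   ≋-refl P₁ Q₁ P₂ Q₂ R₁ R₂ ⟩
      ((P₁ *ₚ R₁) *ₚ (Q₂ *ₚ R₂)) +ₚ ((Q₁ *ₚ R₁) *ₚ (P₂ *ₚ R₂))
        ≈⟨ +ₚ-cong (*ₚ-congʳ rep₁ (Q₂ *ₚ R₂)) (*ₚ-congˡ (Q₁ *ₚ R₁) rep₂) ⟩
      ((numerator G₁ *ₚ Q₁) *ₚ (Q₂ *ₚ R₂)) +ₚ ((Q₁ *ₚ R₁) *ₚ (numerator G₂ *ₚ Q₂))
        ≈⟨ solve 7 (λ u r₁ r₂ s₁ s₂ q₁ q₂ →
              ((((u :* s₁) :+ r₁) :* q₁) :* (q₂ :* r₂)) :+ ((q₁ :* r₁) :* (((u :* s₂) :+ r₂) :* q₂))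
              := (((u :* ((r₁ :* s₂) :+ (s₁ :* r₂))) :+ (r₁ :* r₂)) :* (q₁ :* q₂)) :+ ((q₁ :* q₂) :* (r₁ :* r₂)))
                   ≋-refl 1-p R₁ R₂ S₁ S₂ Q₁ Q₂ ⟩
      (N *ₚ (Q₁ *ₚ Q₂)) +ₚ ((Q₁ *ₚ Q₂) *ₚ (R₁ *ₚ R₂)) ∎

  parallel-representation : ∀ P₁ Q₁ P₂ Q₂ →
    P₁ *ₚ S₁ ≋ (R₁ +ₚ S₁) *ₚ Q₁ → P₂ *ₚ S₂ ≋ (R₂ +ₚ S₂) *ₚ Q₂ →
    (P₁ *ₚ P₂) *ₚ S K (G₁ ∥ G₂) ≋ (R K (G₁ ∥ G₂) +ₚ S K (G₁ ∥ G₂)) *ₚ (Q₁ *ₚ Q₂)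
  parallel-representation P₁ Q₁ P₂ Q₂ rep₁ rep₂ = begin
    (P₁ *ₚ P₂) *ₚ S K (G₁ ∥ G₂)                   ≈⟨ *ₚ-congˡ (P₁ *ₚ P₂) S-parallel ⟩
    (P₁ *ₚ P₂) *ₚ (S₁ *ₚ S₂)
      ≈⟨ solve 4 (λ a b c d → (a :* b) :* (c :* d) := (a :* c) :* (b :* d)) ≋-refl P₁ P₂ S₁ S₂ ⟩
    (P₁ *ₚ S₁) *ₚ (P₂ *ₚ S₂)                      ≈⟨ *ₚ-cong rep₁ rep₂ ⟩
    ((R₁ +ₚ S₁) *ₚ Q₁) *ₚ ((R₂ +ₚ S₂) *ₚ Q₂)
      ≈⟨ solve 6 (λ r₁ r₂ s₁ s₂ q₁ q₂ → ((r₁ :+ s₁) :* q₁) :* ((r₂ :+ s₂) :* q₂)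
                                         := ((((r₁ :* r₂) :+ (r₁ :* s₂)) :+ (s₁ :* r₂)) :+ (s₁ :* s₂)) :* (q₁ :* q₂))
                 ≋-refl R₁ R₂ S₁ S₂ Q₁ Q₂ ⟩
    ((((R₁ *ₚ R₂) +ₚ (R₁ *ₚ S₂)) +ₚ (S₁ *ₚ R₂)) +ₚ (S₁ *ₚ S₂)) *ₚ (Q₁ *ₚ Q₂)
      ≈⟨ *ₚ-congʳ (≋-sym (+ₚ-cong R-parallel S-parallel)) (Q₁ *ₚ Q₂) ⟩
    (R K (G₁ ∥ G₂) +ₚ S K (G₁ ∥ G₂)) *ₚ (Q₁ *ₚ Q₂) ∎

  y-series : y K (G₁ ⋈ G₂) ≈ᵣ ((y K G₁ +ᵣ y K G₂) -ᵣ 1ᵣ K)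
  y-series = coeff-≈ (begin
    numerator (G₁ ⋈ G₂) *ₚ ((R₁ *ₚ R₂) *ₚ constₚ 1#)
      ≈⟨ *ₚ-congˡ (numerator (G₁ ⋈ G₂)) (P.*-identityʳ (R₁ *ₚ R₂)) ⟩
    numerator (G₁ ⋈ G₂) *ₚ (R₁ *ₚ R₂)
      ≈⟨ ≋-sym (series-representation (numerator G₁) R₁ (numerator G₂) R₂ ≋-refl ≋-refl) ⟩
    sum-minus-one (numerator G₁) R₁ (numerator G₂) R₂ *ₚ R K (G₁ ⋈ G₂)
      ≈⟨ *ₚ-congʳ (+ₚ-cong (≋-sym (≋-trans (P.*-identityʳ ((numerator G₁ *ₚ R₂) +ₚ (numerator G₂ *ₚ R₁)))
                                            (+ₚ-cong (≋-refl {numerator G₁ *ₚ R₂}) (*ₚ-comm (numerator G₂) R₁))))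
                           (≋-sym (-1*x≈-x (R₁ *ₚ R₂))))
                  (R K (G₁ ⋈ G₂)) ⟩
    ((((numerator G₁ *ₚ R₂) +ₚ (numerator G₂ *ₚ R₁)) *ₚ constₚ 1#) +ₚ ((-ₚ constₚ 1#) *ₚ (R₁ *ₚ R₂))) *ₚ R K (G₁ ⋈ G₂) ∎)
    where module P = CommutativeRing Poly-ring

  ŷ-parallel : ŷ K (G₁ ∥ G₂) ≈ᵣ (ŷ K G₁ *ᵣ ŷ K G₂)
  ŷ-parallel = coeff-≈ (≋-sym (parallel-representation (R₁ +ₚ S₁) S₁ (R₂ +ₚ S₂) S₂ ≋-refl ≋-refl))

  private
    module K = CommutativeRing K

  eval-sum-minus-one : ∀ P₁ Q₁ P₂ Q₂ x → eval (sum-minus-one P₁ Q₁ P₂ Q₂) x K.≈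
    (eval P₁ x K.* eval Q₂ x K.+ eval Q₁ x K.* eval P₂ x) K.+ K.- (eval Q₁ x K.* eval Q₂ x)
  eval-sum-minus-one P₁ Q₁ P₂ Q₂ x =
    K.trans (eval-+ₚ ((P₁ *ₚ Q₂) +ₚ (Q₁ *ₚ P₂)) (-ₚ (Q₁ *ₚ Q₂)) x)
      (K.+-cong (K.trans (eval-+ₚ (P₁ *ₚ Q₂) (Q₁ *ₚ P₂) x) (K.+-cong (eval-*ₚ P₁ Q₂ x) (eval-*ₚ Q₁ P₂ x)))
                (K.trans (eval--ₚ (Q₁ *ₚ Q₂) x) (K.-‿cong (eval-*ₚ Q₁ Q₂ x))))

  module _ (P₁ Q₁ P₂ Q₂ : Poly K) {d₁ d₂} (P₁≤d₁ : DegreeAtMost d₁ P₁) (Q₁≤d₁ : DegreeAtMost d₁ Q₁)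
           (P₂≤d₂ : DegreeAtMost d₂ P₂) (Q₂≤d₂ : DegreeAtMost d₂ Q₂) where

    degree-sum-minus-one : DegreeAtMost (d₁ +ℕ d₂) (sum-minus-one P₁ Q₁ P₂ Q₂)
    degree-sum-minus-one =
      length-+ₚ ((P₁ *ₚ Q₂) +ₚ (Q₁ *ₚ P₂)) (-ₚ (Q₁ *ₚ Q₂))
        (length-+ₚ (P₁ *ₚ Q₂) (Q₁ *ₚ P₂) (length-*ₚ P₁ Q₂ d₁ d₂ P₁≤d₁ Q₂≤d₂) (length-*ₚ Q₁ P₂ d₁ d₂ Q₁≤d₁ P₂≤d₂))
        (≡.subst (_≤ _) (≡.sym (length--ₚ (Q₁ *ₚ Q₂))) (length-*ₚ Q₁ Q₂ d₁ d₂ Q₁≤d₁ Q₂≤d₂))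

    top-sum-minus-one : coeff (sum-minus-one P₁ Q₁ P₂ Q₂) (d₁ +ℕ d₂) K.≈
      (coeff P₁ d₁ K.* coeff Q₂ d₂ K.+ coeff Q₁ d₁ K.* coeff P₂ d₂) K.+ K.- (coeff Q₁ d₁ K.* coeff Q₂ d₂)
    top-sum-minus-one =
      K.trans (coeff-+ₚ ((P₁ *ₚ Q₂) +ₚ (Q₁ *ₚ P₂)) (-ₚ (Q₁ *ₚ Q₂)) _)
        (K.+-cong (K.trans (coeff-+ₚ (P₁ *ₚ Q₂) (Q₁ *ₚ P₂) _)
                           (K.+-cong (coeff-*ₚ-top P₁ Q₂ d₁ d₂ P₁≤d₁ Q₂≤d₂) (coeff-*ₚ-top Q₁ P₂ d₁ d₂ Q₁≤d₁ P₂≤d₂)))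
                  (K.trans (coeff--ₚ (Q₁ *ₚ Q₂) _) (K.-‿cong (coeff-*ₚ-top Q₁ Q₂ d₁ d₂ Q₁≤d₁ Q₂≤d₂))))

  y-series-value : ∀ (p₀ v₁ v₂ : Ĉ K) → HasValue K (y K G₁) p₀ v₁ → HasValue K (y K G₂) p₀ v₂ →
    ¬ (v₁ ≡ ∞ × v₂ ≡ ∞) → HasValue K (y K (G₁ ⋈ G₂)) p₀ ((v₁ +̂ v₂) -̂ 1̂ K)
  y-series-value (fin x) v₁ v₂ (P₁ , Q₁ , rep₁ , val₁) (P₂ , Q₂ , rep₂ , val₂) not-both =
    sum-minus-one P₁ Q₁ P₂ Q₂ , Q₁ *ₚ Q₂ ,
    coeff-≈ (series-representation P₁ Q₁ P₂ Q₂ (coeffwise rep₁) (coeffwise rep₂)) ,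
    FracIs-cong ((v₁ +̂ v₂) -̂ 1̂ K) (K.sym (eval-sum-minus-one P₁ Q₁ P₂ Q₂ x)) (K.sym (eval-*ₚ Q₁ Q₂ x))
                (FracIs-sum-minus-one v₁ v₂ val₁ val₂ not-both)
  y-series-value ∞ v₁ v₂ (P₁ , Q₁ , rep₁ , d₁ , P₁≤d₁ , Q₁≤d₁ , val₁) (P₂ , Q₂ , rep₂ , d₂ , P₂≤d₂ , Q₂≤d₂ , val₂) not-both =
    sum-minus-one P₁ Q₁ P₂ Q₂ , Q₁ *ₚ Q₂ ,
    coeff-≈ (series-representation P₁ Q₁ P₂ Q₂ (coeffwise rep₁) (coeffwise rep₂)) ,
    d₁ +ℕ d₂ , degree-sum-minus-one P₁ Q₁ P₂ Q₂ P₁≤d₁ Q₁≤d₁ P₂≤d₂ Q₂≤d₂ , length-*ₚ Q₁ Q₂ d₁ d₂ Q₁≤d₁ Q₂≤d₂ ,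
    FracIs-cong ((v₁ +̂ v₂) -̂ 1̂ K) (K.sym (top-sum-minus-one P₁ Q₁ P₂ Q₂ P₁≤d₁ Q₁≤d₁ P₂≤d₂ Q₂≤d₂))
                (K.sym (coeff-*ₚ-top Q₁ Q₂ d₁ d₂ Q₁≤d₁ Q₂≤d₂))
                (FracIs-sum-minus-one v₁ v₂ val₁ val₂ not-both)

  ŷ-parallel-value : ∀ (p₀ w₁ w₂ : Ĉ K) → HasValue K (ŷ K G₁) p₀ w₁ → HasValue K (ŷ K G₂) p₀ w₂ →
    ¬ (IsZeroĈ K w₁ × w₂ ≡ ∞) → ¬ (w₁ ≡ ∞ × IsZeroĈ K w₂) → HasValue K (ŷ K (G₁ ∥ G₂)) p₀ (w₁ *̂ w₂)
  ŷ-parallel-value (fin x) w₁ w₂ (P₁ , Q₁ , rep₁ , val₁) (P₂ , Q₂ , rep₂ , val₂) not-0-∞ not-∞-0 =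
    P₁ *ₚ P₂ , Q₁ *ₚ Q₂ ,
    coeff-≈ (parallel-representation P₁ Q₁ P₂ Q₂ (coeffwise rep₁) (coeffwise rep₂)) ,
    FracIs-cong (w₁ *̂ w₂) (K.sym (eval-*ₚ P₁ P₂ x)) (K.sym (eval-*ₚ Q₁ Q₂ x))
                (FracIs-product w₁ w₂ val₁ val₂ not-0-∞ not-∞-0)
  ŷ-parallel-value ∞ w₁ w₂ (P₁ , Q₁ , rep₁ , d₁ , P₁≤d₁ , Q₁≤d₁ , val₁) (P₂ , Q₂ , rep₂ , d₂ , P₂≤d₂ , Q₂≤d₂ , val₂)
                   not-0-∞ not-∞-0 =
    P₁ *ₚ P₂ , Q₁ *ₚ Q₂ ,
    coeff-≈ (parallel-representation P₁ Q₁ P₂ Q₂ (coeffwise rep₁) (coeffwise rep₂)) ,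
    d₁ +ℕ d₂ , length-*ₚ P₁ P₂ d₁ d₂ P₁≤d₁ P₂≤d₂ , length-*ₚ Q₁ Q₂ d₁ d₂ Q₁≤d₁ Q₂≤d₂ ,
    FracIs-cong (w₁ *̂ w₂) (K.sym (coeff-*ₚ-top P₁ P₂ d₁ d₂ P₁≤d₁ P₂≤d₂)) (K.sym (coeff-*ₚ-top Q₁ Q₂ d₁ d₂ Q₁≤d₁ Q₂≤d₂))
                (FracIs-product w₁ w₂ val₁ val₂ not-0-∞ not-∞-0)

lemma2p3 : ∀ {c ℓ} (K : CommutativeRing c ℓ) → IsACF0 K → (G₁ G₂ : TwoTerminal) →
    (y K (G₁ ⋈ G₂) ≈ᵣ ((y K G₁ +ᵣ y K G₂) -ᵣ 1ᵣ K))
    × (ŷ K (G₁ ∥ G₂) ≈ᵣ (ŷ K G₁ *ᵣ ŷ K G₂))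
    × (∀ (p₀ v₁ v₂ : Ĉ K) → HasValue K (y K G₁) p₀ v₁ → HasValue K (y K G₂) p₀ v₂ →
         ¬ (v₁ ≡ ∞ × v₂ ≡ ∞) →
         HasValue K (y K (G₁ ⋈ G₂)) p₀ ((v₁ +̂ v₂) -̂ 1̂ K))
    × (∀ (p₀ w₁ w₂ : Ĉ K) → HasValue K (ŷ K G₁) p₀ w₁ → HasValue K (ŷ K G₂) p₀ w₂ →
         ¬ (IsZeroĈ K w₁ × w₂ ≡ ∞) → ¬ (w₁ ≡ ∞ × IsZeroĈ K w₂) →
         HasValue K (ŷ K (G₁ ∥ G₂)) p₀ (w₁ *̂ w₂))
lemma2p3 K field-K G₁ G₂ = y-series , ŷ-parallel , y-series-value , ŷ-parallel-value
  where open Composition K field-K G₁ G₂
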